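{- Let $d_1,d_2$ be positive integers with $3\mid d_1+d_2$, and let $S(d_1,d_2)$ be the vertex-disjoint union of a star with $d_1$ edges and a star with $d_2$ edges. Then \[ R(S(d_1,d_2),\mathbb{Z}_3)=\begin{cases} d_1+d_2+3, & \text{if } \{d_1,d_2\}\equiv\{1,2\}\pmod 3;\\ d_1+d_2+2, & \text{if } d_1\equiv d_2\equiv 0 \pmod 3.\end{cases} \]
   Context: For a graph $G$ with $3\mid e(G)$, $R(G,\mathbb{Z}_3)$ is the least integer $N$ such that for every edge-coloring $\chi: E(K_N)\to\mathbb{Z}_3$ there is a subgraph of $K_N$ isomorphic to $G$ whose edge colors sum to $0$ in $\mathbb{Z}_3$. -}

module Defs where

open import Data.Nat using (ℕ; zero; suc; _+_; _<_; _%_)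
open import Data.Fin using (Fin; zero; suc; toℕ; _↑ˡ_; _↑ʳ_)
open import Data.List using (List; map; _++_; allFin)
open import Data.Nat.ListAction using (sum)
open import Data.Product using (_×_; _,_; Σ; ∃)
open import Function.Definitions using (Injective)
open import Relation.Binary.PropositionalEquality using (_≡_)
open import Relation.Nullary using (¬_)

record Graph : Set where
  constructor mkGraph
  field
    V     : ℕ
    edges : List (Fin V × Fin V)
open Graph public

e : Graph → ℕ
e G = Data.List.length (edges G)

-- Edge-colorings of K_N with colors in ℤ₃ = Fin 3 (symmetric functions
-- on pairs of vertices; the diagonal is irrelevant).
Coloring : ℕ → Set
Coloring N = Fin N → Fin N → Fin 3

Symmetric : ∀ {N} → Coloring N → Set
Symmetric {N} χ = ∀ (i j : Fin N) → χ i j ≡ χ j i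

copySum : ∀ {N} (G : Graph) → Coloring N → (Fin (V G) → Fin N) → ℕ
copySum G χ f =
  sum (map (λ { (a , b) → toℕ (χ (f a) (f b)) }) (edges G)) % 3

ZeroSumProp : Graph → ℕ → Set
ZeroSumProp G N =
  (χ : Coloring N) → Symmetric χ →
  Σ (Fin (V G) → Fin N) λ f → Injective _≡_ _≡_ f × copySum G χ f ≡ 0

IsZ3Ramsey : Graph → ℕ → Set
IsZ3Ramsey G N = ZeroSumProp G N × (∀ M → M < N → ¬ ZeroSumProp G M)

-- S(d₁,d₂): vertex-disjoint union of a star with d₁ edges (center the
-- first vertex of the first block of suc d₁ vertices) and a star with d₂
-- edges (center the first vertex of the second block of suc d₂ vertices).
S : ℕ → ℕ → Graph
S d₁ d₂ = mkGraph (suc d₁ + suc d₂)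
  (map (λ i → (zero ↑ˡ suc d₂) , (suc i ↑ˡ suc d₂)) (allFin d₁)
   ++ map (λ j → (suc d₁ ↑ʳ zero) , (suc d₁ ↑ʳ suc j)) (allFin d₂))

{-# OPTIONS --safe #-}
module Submission where

-- If the second star of a zero-sum copy has
-- 3k + d leaves with d ≥ 2, the Erdős–Ginzburg–Ziv theorem for ℤ₃ yields 3k of them on which
-- χ(c₁,·) − χ(c₂,·) sums to zero, and handing them to the first star keeps the sum zero.  So the upper
-- bounds reduce to the smallest first star: a zero-sum S(1, N−4) in every colouring of K_N with
-- N ≡ 0 (mod 3), N ≥ 6, and a zero-sum S(3, N−5) when N ≡ 2 (mod 3), N ≥ 8.  Both are proved by
-- contradiction.  In the first case every vertex sees at most two colours, and a case analysis on the
-- sizes of the colour classes at one vertex exhibits a zero-sum copy after all.  In the second, let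
-- deg v be the sum of the colours at v.  Without a zero-sum S(0, N−2) no edge at v has colour deg v,
-- so every other colour occurs ≡ 2 (mod 3) times at v; without a zero-sum S(3, N−5) the function
-- χ(u,·) − χ(v,·) is constant up to one vertex.  Together these make vertices of equal degree twins,
-- and counting colours modulo 3 around three vertices of equal degree is contradictory.
-- For the lower bounds, K_M with M < |S| contains no copy at all, and when d₁, d₂ ≢ 0 (mod 3) the
-- colouring of K_|S| with colour 1 exactly on the edges at one vertex gives every copy the sum
-- 1, d₁ or d₂.

open import Defs
open import Data.Nat using (ℕ; _+_; _%_; _≤_)
open import Data.Nat.Divisibility using (_∣_)
open import Data.Product using (_×_)
open import Data.Sum using (_⊎_)
open import Relation.Binary.PropositionalEquality using (_≡_)

open import Data.Bool using (if_then_else_)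
open import Data.Empty using (⊥; ⊥-elim)
open import Data.Fin using (Fin; zero; suc; toℕ; splitAt; join; _↑ˡ_; _↑ʳ_; punchOut)
open import Data.Fin.Patterns using (0F; 1F; 2F)
open import Data.Fin.Properties
  using (_≟_; all?; any?; toℕ-fromℕ<; toℕ<n; toℕ-injective; splitAt-↑ˡ; splitAt-↑ʳ; join-splitAt; injective⇒≤;
         punchOut-injective; ↑ˡ-injective; ↑ʳ-injective; suc-injective)
open import Data.List using (List; []; _∷_; _++_; map; length; allFin; lookup; tabulate; filter)
import Data.List.Properties as List
open import Data.List.Membership.Propositional using (_∈_; _∉_)
open import Data.List.Membership.Propositional.Properties using (∈-++⁺ʳ; ∈-++⁻; ∈-lookup; ∈-∃++; ∈-allFin)
open import Data.List.Relation.Binary.Permutation.Propositional using (_↭_; ↭-refl; ↭-sym; ↭-trans; ↭-prep; ↭-swap; ↭⇒↭ₛ)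
import Data.List.Relation.Binary.Permutation.Propositional as ↭
open import Data.List.Relation.Binary.Permutation.Propositional.Properties
  using (∈-resp-↭; ↭-length; ++⁺ˡ; ++⁺ʳ; shift; ++-comm; map⁺; ∷↭∷ʳ)
import Data.List.Relation.Binary.Permutation.Setoid.Properties as PermSetoid
open import Data.List.Relation.Ternary.Interleaving.Propositional using (Interleaving; []; consˡ; consʳ; toPermutation)
open import Data.List.Relation.Unary.All as All using (All; []; _∷_)
open import Data.List.Relation.Unary.All.Properties using (¬Any⇒All¬; All¬⇒¬Any; all-filter) renaming (++⁻ˡ to All-++⁻ˡ)
open import Data.List.Relation.Unary.AllPairs using ([]; _∷_)
open import Data.List.Relation.Unary.Any as Any using (Any; here; there)
open import Data.List.Relation.Unary.Any.Properties using (lookup-index)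
open import Data.List.Relation.Unary.Unique.Propositional using (Unique)
open import Data.List.Relation.Unary.Unique.Propositional.Properties using (allFin⁺; filter⁺)
import Data.List.Relation.Unary.Unique.DecPropositional as UniqueDec
open import Data.Nat using (zero; suc; _*_; _<_; z≤n; s≤s)
open import Data.Nat.DivMod using (_mod_; _/_; %-distribˡ-+; m<n⇒m%n≡m; m≡m%n+[m/n]*n; m%n≤m)
open import Data.Nat.ListAction using (sum)
import Data.Nat.Properties as ℕ
open import Data.Nat.Solver using (module +-*-Solver)
open import Data.Product using (Σ; ∃; ∃₂; _,_; proj₁; proj₂)
open import Data.Sum using (inj₁; inj₂; [_,_]′)
open import Function using (_∘_; case_of_)
open import Function.Definitions using (Injective)
open import Relation.Binary.PropositionalEquality
  using (refl; sym; trans; cong; cong₂; subst; _≢_; ≢-sym; setoid; module ≡-Reasoning)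
open import Relation.Nullary using (¬_; Dec; does; yes; no; contradiction)
open import Relation.Nullary.Decidable using (from-yes; ¬?; _→-dec_; _×-dec_; decidable-stable; True; toWitness)

ℤ₃ : Set
ℤ₃ = Fin 3

[_]₃ : ℕ → ℤ₃
[ n ]₃ = n mod 3

infixl 6 _⊕_ _⊖_
infixl 7 _⊗_
infix  8 ⊖_

_⊕_ : ℤ₃ → ℤ₃ → ℤ₃
0F ⊕ b  = b
1F ⊕ 0F = 1F
1F ⊕ 1F = 2F
1F ⊕ 2F = 0F
2F ⊕ 0F = 2F
2F ⊕ 1F = 0F
2F ⊕ 2F = 1F

⊖_ : ℤ₃ → ℤ₃
⊖ 0F = 0F
⊖ 1F = 2F
⊖ 2F = 1F

_⊖_ : ℤ₃ → ℤ₃ → ℤ₃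
a ⊖ b = a ⊕ ⊖ b

_⊗_ : ℤ₃ → ℤ₃ → ℤ₃
0F ⊗ b = 0F
1F ⊗ b = b
2F ⊗ b = ⊖ b

toℕ-[n]₃ : ∀ n → toℕ [ n ]₃ ≡ n % 3
toℕ-[n]₃ n = toℕ-fromℕ< _

toℕ-⊕ : ∀ a b → toℕ (a ⊕ b) ≡ (toℕ a + toℕ b) % 3
toℕ-⊕ = from-yes (all? λ a → all? λ b → toℕ (a ⊕ b) ℕ.≟ (toℕ a + toℕ b) % 3)

[m+n]₃≡[m]₃⊕[n]₃ : ∀ m n → [ m + n ]₃ ≡ [ m ]₃ ⊕ [ n ]₃
[m+n]₃≡[m]₃⊕[n]₃ m n = toℕ-injective (begin
  toℕ [ m + n ]₃                 ≡⟨ toℕ-[n]₃ (m + n) ⟩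
  (m + n) % 3                    ≡⟨ %-distribˡ-+ m n 3 ⟩
  (m % 3 + n % 3) % 3            ≡⟨ cong₂ (λ x y → (x + y) % 3) (toℕ-[n]₃ m) (toℕ-[n]₃ n) ⟨
  (toℕ [ m ]₃ + toℕ [ n ]₃) % 3  ≡⟨ toℕ-⊕ [ m ]₃ [ n ]₃ ⟨
  toℕ ([ m ]₃ ⊕ [ n ]₃)          ∎)
  where open ≡-Reasoning

⊕-comm : ∀ a b → a ⊕ b ≡ b ⊕ a
⊕-comm = from-yes (all? λ a → all? λ b → a ⊕ b ≟ b ⊕ a)

⊕-assoc : ∀ a b c → a ⊕ b ⊕ c ≡ a ⊕ (b ⊕ c)
⊕-assoc = from-yes (all? λ a → all? λ b → all? λ c → a ⊕ b ⊕ c ≟ a ⊕ (b ⊕ c))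

third-value : ∀ {p q t : ℤ₃} → p ≢ q → t ≢ p → t ≢ q → t ≡ ⊖ (p ⊕ q)
third-value {p} {q} {t} = from-yes (all? λ p → all? λ q → all? λ t →
  ¬? (p ≟ q) →-dec ¬? (t ≟ p) →-dec ¬? (t ≟ q) →-dec t ≟ ⊖ (p ⊕ q)) p q t

three-values-cover : ∀ {p q r : ℤ₃} (t : ℤ₃) → p ≢ q → p ≢ r → q ≢ r → t ≡ p ⊎ t ≡ q ⊎ t ≡ r
three-values-cover {p} {q} t p≢q p≢r q≢r with t ≟ p | t ≟ q
... | yes t≡p | _        = inj₁ t≡p
... | no _    | yes t≡q  = inj₂ (inj₁ t≡q)
... | no t≢p  | no t≢q   =
  inj₂ (inj₂ (trans (third-value p≢q t≢p t≢q) (sym (third-value p≢q (≢-sym p≢r) (≢-sym q≢r)))))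

difference-cases : ∀ {α β : ℤ₃} (τ : ℤ₃) → α ≢ β → τ ≡ α ⊖ α ⊎ τ ≡ α ⊖ β ⊎ τ ≡ β ⊖ α
difference-cases {α} {β} τ α≢β = three-values-cover τ (distinct α β α≢β) (distinct′ α β α≢β) (distinct″ α β α≢β)
  where
  distinct : ∀ α β → α ≢ β → α ⊖ α ≢ α ⊖ β
  distinct = from-yes (all? λ α → all? λ β → ¬? (α ≟ β) →-dec ¬? (α ⊖ α ≟ α ⊖ β))
  distinct′ : ∀ α β → α ≢ β → α ⊖ α ≢ β ⊖ α
  distinct′ = from-yes (all? λ α → all? λ β → ¬? (α ≟ β) →-dec ¬? (α ⊖ α ≟ β ⊖ α))
  distinct″ : ∀ α β → α ≢ β → α ⊖ β ≢ β ⊖ α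
  distinct″ = from-yes (all? λ α → all? λ β → ¬? (α ≟ β) →-dec ¬? (α ⊖ β ≟ β ⊖ α))

∑ : {A : Set} → List A → (A → ℤ₃) → ℤ₃
∑ []       f = 0F
∑ (x ∷ xs) f = f x ⊕ ∑ xs f

syntax ∑ xs (λ x → e) = ∑[ x ∈ xs ] e

∑-tabulate : ∀ {A : Set} {n} (g : Fin n → A) (f : A → ℤ₃) → ∑ (tabulate g) f ≡ ∑ (allFin n) (f ∘ g)
∑-tabulate {n = zero}  g f = refl
∑-tabulate {n = suc n} g f =
  cong (f (g zero) ⊕_) (trans (∑-tabulate (g ∘ suc) f) (sym (∑-tabulate suc (f ∘ g))))

module _ {A : Set} where

  ∑-++ : ∀ xs ys (f : A → ℤ₃) → ∑ (xs ++ ys) f ≡ ∑ xs f ⊕ ∑ ys f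
  ∑-++ []       ys f = refl
  ∑-++ (x ∷ xs) ys f = trans (cong (f x ⊕_) (∑-++ xs ys f)) (sym (⊕-assoc (f x) _ _))

  ∑-↭ : ∀ (f : A → ℤ₃) {xs ys} → xs ↭ ys → ∑ xs f ≡ ∑ ys f
  ∑-↭ f ↭.refl              = refl
  ∑-↭ f (↭.prep x p)        = cong (f x ⊕_) (∑-↭ f p)
  ∑-↭ f (↭.swap x y p)      = trans (cong (λ s → f x ⊕ (f y ⊕ s)) (∑-↭ f p)) (swap (f x) (f y) _)
    where
    swap : ∀ a b c → a ⊕ (b ⊕ c) ≡ b ⊕ (a ⊕ c)
    swap = from-yes (all? λ a → all? λ b → all? λ c → a ⊕ (b ⊕ c) ≟ b ⊕ (a ⊕ c))
  ∑-↭ f (↭.trans p q)       = trans (∑-↭ f p) (∑-↭ f q)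

  ∑-cong : ∀ xs {f g : A → ℤ₃} → (∀ {x} → x ∈ xs → f x ≡ g x) → ∑ xs f ≡ ∑ xs g
  ∑-cong []       f≡g = refl
  ∑-cong (x ∷ xs) f≡g = cong₂ _⊕_ (f≡g (here refl)) (∑-cong xs (f≡g ∘ there))

  ∑-⊕ : ∀ xs (f g : A → ℤ₃) → ∑[ x ∈ xs ] (f x ⊕ g x) ≡ ∑ xs f ⊕ ∑ xs g
  ∑-⊕ []       f g = refl
  ∑-⊕ (x ∷ xs) f g = trans (cong (f x ⊕ g x ⊕_) (∑-⊕ xs f g)) (interchange (f x) (g x) _ _)
    where
    interchange : ∀ a b c d → a ⊕ b ⊕ (c ⊕ d) ≡ a ⊕ c ⊕ (b ⊕ d)
    interchange = from-yes (all? λ a → all? λ b → all? λ c → all? λ d →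
      a ⊕ b ⊕ (c ⊕ d) ≟ a ⊕ c ⊕ (b ⊕ d))

  ∑-⊖ : ∀ xs (f g : A → ℤ₃) → ∑[ x ∈ xs ] (f x ⊖ g x) ≡ ∑ xs f ⊖ ∑ xs g
  ∑-⊖ []       f g = refl
  ∑-⊖ (x ∷ xs) f g = trans (cong (f x ⊖ g x ⊕_) (∑-⊖ xs f g)) (interchange (f x) (g x) _ _)
    where
    interchange : ∀ a b c d → a ⊖ b ⊕ (c ⊖ d) ≡ a ⊕ c ⊖ (b ⊕ d)
    interchange = from-yes (all? λ a → all? λ b → all? λ c → all? λ d →
      a ⊖ b ⊕ (c ⊖ d) ≟ a ⊕ c ⊖ (b ⊕ d))

  ∑-affine : ∀ xs (a : A → ℤ₃) p q →
    ∑[ x ∈ xs ] (a x ⊗ p ⊕ (1F ⊖ a x) ⊗ q) ≡ ∑ xs a ⊗ p ⊕ ([ length xs ]₃ ⊖ ∑ xs a) ⊗ q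
  ∑-affine []       a p q = from-yes (all? λ p → all? λ q → 0F ≟ 0F ⊗ p ⊕ (0F ⊖ 0F) ⊗ q) p q
  ∑-affine (x ∷ xs) a p q = begin
    a x ⊗ p ⊕ (1F ⊖ a x) ⊗ q ⊕ ∑[ y ∈ xs ] (a y ⊗ p ⊕ (1F ⊖ a y) ⊗ q)
      ≡⟨ cong (a x ⊗ p ⊕ (1F ⊖ a x) ⊗ q ⊕_) (∑-affine xs a p q) ⟩
    a x ⊗ p ⊕ (1F ⊖ a x) ⊗ q ⊕ (∑ xs a ⊗ p ⊕ ([ length xs ]₃ ⊖ ∑ xs a) ⊗ q)
      ≡⟨ from-yes (all? λ b → all? λ s → all? λ L → all? λ p → all? λ q →
           b ⊗ p ⊕ (1F ⊖ b) ⊗ q ⊕ (s ⊗ p ⊕ (L ⊖ s) ⊗ q) ≟ (b ⊕ s) ⊗ p ⊕ (1F ⊕ L ⊖ (b ⊕ s)) ⊗ q)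
           (a x) (∑ xs a) [ length xs ]₃ p q ⟩
    (a x ⊕ ∑ xs a) ⊗ p ⊕ (1F ⊕ [ length xs ]₃ ⊖ (a x ⊕ ∑ xs a)) ⊗ q
      ≡⟨ cong (λ L → (a x ⊕ ∑ xs a) ⊗ p ⊕ (L ⊖ (a x ⊕ ∑ xs a)) ⊗ q) ([m+n]₃≡[m]₃⊕[n]₃ 1 (length xs)) ⟨
    (a x ⊕ ∑ xs a) ⊗ p ⊕ ([ length (x ∷ xs) ]₃ ⊖ (a x ⊕ ∑ xs a)) ⊗ q
      ∎
    where open ≡-Reasoning

  ∑-const : ∀ (xs : List A) (c : ℤ₃) → ∑[ x ∈ xs ] c ≡ [ length xs ]₃ ⊗ c
  ∑-const []       c = from-yes (all? λ c → 0F ≟ 0F ⊗ c) c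
  ∑-const (x ∷ xs) c = begin
    c ⊕ ∑[ x ∈ xs ] c              ≡⟨ cong (c ⊕_) (∑-const xs c) ⟩
    c ⊕ [ length xs ]₃ ⊗ c         ≡⟨ from-yes (all? λ n → all? λ c → c ⊕ n ⊗ c ≟ (1F ⊕ n) ⊗ c) [ length xs ]₃ c ⟩
    (1F ⊕ [ length xs ]₃) ⊗ c      ≡⟨ cong (_⊗ c) ([m+n]₃≡[m]₃⊕[n]₃ 1 (length xs)) ⟨
    [ length (x ∷ xs) ]₃ ⊗ c       ∎
    where open ≡-Reasoning

  ∑-map : ∀ {B : Set} (g : B → A) xs (f : A → ℤ₃) → ∑ (map g xs) f ≡ ∑ xs (f ∘ g)
  ∑-map g []       f = refl
  ∑-map g (x ∷ xs) f = cong (f (g x) ⊕_) (∑-map g xs f)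

  ∑-lookup : ∀ xs (f : A → ℤ₃) → ∑ (allFin (length xs)) (f ∘ lookup xs) ≡ ∑ xs f
  ∑-lookup xs f = trans (sym (∑-tabulate (lookup xs) f)) (cong (λ ys → ∑ ys f) (List.tabulate-lookup xs))

  sum-toℕ-%3 : ∀ xs (f : A → ℤ₃) → sum (map (toℕ ∘ f) xs) % 3 ≡ toℕ (∑ xs f)
  sum-toℕ-%3 []       f = refl
  sum-toℕ-%3 (x ∷ xs) f = begin
    (toℕ (f x) + sum (map (toℕ ∘ f) xs)) % 3              ≡⟨ %-distribˡ-+ (toℕ (f x)) _ 3 ⟩
    (toℕ (f x) % 3 + sum (map (toℕ ∘ f) xs) % 3) % 3      ≡⟨ cong₂ (λ a b → (a + b) % 3)
                                                              (m<n⇒m%n≡m (toℕ<n (f x))) (sum-toℕ-%3 xs f) ⟩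
    (toℕ (f x) + toℕ (∑ xs f)) % 3                        ≡⟨ toℕ-⊕ (f x) (∑ xs f) ⟨
    toℕ (f x ⊕ ∑ xs f)                                    ∎
    where open ≡-Reasoning

distinct₄ : ∀ {A : Set} {a b c d : A} → a ≢ b → a ≢ c → a ≢ d → b ≢ c → b ≢ d → c ≢ d → Unique (a ∷ b ∷ c ∷ d ∷ [])
distinct₄ a≢b a≢c a≢d b≢c b≢d c≢d = (a≢b ∷ a≢c ∷ a≢d ∷ []) ∷ (b≢c ∷ b≢d ∷ []) ∷ (c≢d ∷ []) ∷ [] ∷ []

module _ {A : Set} where

  Unique-resp-↭ : ∀ {xs ys : List A} → xs ↭ ys → Unique xs → Unique ys
  Unique-resp-↭ p = PermSetoid.Unique-resp-↭ (setoid A) (↭⇒↭ₛ p)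

  Unique-++⁻ˡ : ∀ xs {ys : List A} → Unique (xs ++ ys) → Unique xs
  Unique-++⁻ˡ []       _          = []
  Unique-++⁻ˡ (x ∷ xs) (x∉ ∷ u)  = All-++⁻ˡ xs x∉ ∷ Unique-++⁻ˡ xs u

  Unique-++⁻ʳ : ∀ xs {ys : List A} → Unique (xs ++ ys) → Unique ys
  Unique-++⁻ʳ []       u        = u
  Unique-++⁻ʳ (x ∷ xs) (_ ∷ u)  = Unique-++⁻ʳ xs u

  Unique-++⇒disjoint : ∀ xs {ys : List A} → Unique (xs ++ ys) → ∀ {x y} → x ∈ xs → y ∈ ys → x ≢ y
  Unique-++⇒disjoint (x ∷ xs) (x∉ ∷ _) (here refl) y∈ys = All.lookup x∉ (∈-++⁺ʳ xs y∈ys)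
  Unique-++⇒disjoint (x ∷ xs) (_ ∷ u)  (there x∈xs) y∈ys = Unique-++⇒disjoint xs u x∈xs y∈ys

  Unique-snoc : ∀ {xs : List A} {y} → Unique xs → All (y ≢_) xs → Unique (xs ++ y ∷ [])
  Unique-snoc {xs} {y} distinct y∉xs = Unique-resp-↭ (∷↭∷ʳ y xs) (y∉xs ∷ distinct)

  lookup-injective : ∀ {xs : List A} → Unique xs → Injective _≡_ _≡_ (lookup xs)
  lookup-injective {x ∷ xs} (x∉ ∷ u) {zero}  {zero}  _ = refl
  lookup-injective {x ∷ xs} (x∉ ∷ u) {zero}  {suc j} e = contradiction e (All.lookup x∉ (∈-lookup j))
  lookup-injective {x ∷ xs} (x∉ ∷ u) {suc i} {zero}  e = contradiction (sym e) (All.lookup x∉ (∈-lookup i))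
  lookup-injective {x ∷ xs} (x∉ ∷ u) {suc i} {suc j} e = cong suc (lookup-injective u e)

  peel : ∀ {xs ys : List A} → Unique xs → All (_∈ ys) xs → ∃ λ zs → ys ↭ xs ++ zs
  peel {[]}     {ys} _ _ = ys , ↭-refl
  peel {x ∷ xs} (x∉xs ∷ u) (x∈ys ∷ xs⊆ys) with peel u xs⊆ys
  ... | zs , ys↭ with ∈-++⁻ xs (∈-resp-↭ ys↭ x∈ys)
  ...   | inj₁ x∈xs = contradiction x∈xs (All¬⇒¬Any x∉xs)
  ...   | inj₂ x∈zs with ∈-∃++ x∈zs
  ...     | ps , qs , refl = ps ++ qs , ↭-trans ys↭ (begin
    xs ++ ps ++ x ∷ qs     ≡⟨ List.++-assoc xs ps (x ∷ qs) ⟨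
    (xs ++ ps) ++ x ∷ qs   ↭⟨ shift x (xs ++ ps) qs ⟩
    x ∷ (xs ++ ps) ++ qs   ≡⟨ cong (x ∷_) (List.++-assoc xs ps qs) ⟩
    x ∷ xs ++ ps ++ qs     ∎)
    where open ↭.PermutationReasoning

module _ {N : ℕ} where

  open import Data.List.Membership.DecPropositional (_≟_ {N}) using (_∈?_)

  complement : ∀ {xs : List (Fin N)} → Unique xs → ∃ λ zs → allFin N ↭ xs ++ zs
  complement u = peel u (All.tabulate λ {x} _ → ∈-allFin x)

  complement-≢ : ∀ xs {zs} → allFin N ↭ xs ++ zs → ∀ {x y} → x ∈ xs → y ∈ zs → y ≢ x
  complement-≢ xs all↭ x∈xs y∈zs = ≢-sym (Unique-++⇒disjoint xs (Unique-resp-↭ all↭ (allFin⁺ N)) x∈xs y∈zs)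

  [length-complement]₃ : ∀ {xs zs} → allFin N ↭ xs ++ zs → [ length zs ]₃ ≡ [ N ]₃ ⊖ [ length xs ]₃
  [length-complement]₃ {xs} {zs} all↭ = begin
    [ length zs ]₃                                  ≡⟨ from-yes (all? λ a → all? λ b → b ≟ a ⊕ b ⊖ a) [ length xs ]₃ [ length zs ]₃ ⟩
    [ length xs ]₃ ⊕ [ length zs ]₃ ⊖ [ length xs ]₃  ≡⟨ cong (_⊖ [ length xs ]₃) ([m+n]₃≡[m]₃⊕[n]₃ (length xs) (length zs)) ⟨
    [ length xs + length zs ]₃ ⊖ [ length xs ]₃       ≡⟨ cong (λ n → [ n ]₃ ⊖ [ length xs ]₃) |xs++zs|≡N ⟩
    [ N ]₃ ⊖ [ length xs ]₃                          ∎
    where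
    open ≡-Reasoning
    |xs++zs|≡N : length xs + length zs ≡ N
    |xs++zs|≡N = trans (sym (List.length-++ xs)) (trans (sym (↭-length all↭)) (List.length-tabulate (λ i → i)))

  others : ∀ v → ∃ λ R → allFin N ↭ v ∷ R
  others v = complement {xs = v ∷ []} ([] ∷ [])

  ≢centre : ∀ {v R y} → allFin N ↭ v ∷ R → y ∈ R → y ≢ v
  ≢centre {v} all↭ = complement-≢ (v ∷ []) all↭ (here refl)

  fresh : ∀ (xs : List (Fin N)) → length xs < N → ∃ λ y → All (y ≢_) xs
  fresh xs len with any? (λ y → ¬? (y ∈? xs))
  ... | yes (y , y∉xs) = y , ¬Any⇒All¬ xs y∉xs
  ... | no none = contradiction (injective⇒≤ position-injective) (ℕ.<⇒≱ len)
    where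
    everywhere : ∀ y → y ∈ xs
    everywhere y = decidable-stable (y ∈? xs) (λ y∉xs → none (y , y∉xs))
    position-injective : Injective _≡_ _≡_ (λ y → Any.index (everywhere y))
    position-injective {y} {y′} e =
      trans (lookup-index (everywhere y)) (trans (cong (lookup xs) e) (sym (lookup-index (everywhere y′))))

  fresh-below : ∀ {b} → b ≤ N → (xs : List (Fin N)) {_ : True (length xs ℕ.<? b)} → ∃ λ y → All (y ≢_) xs
  fresh-below b≤N xs {short} = fresh xs (ℕ.≤-trans (toWitness short) b≤N)

  one-of-three-avoiding : ∀ {P : Fin N → Set} {p₁ p₂ p₃} → Unique (p₁ ∷ p₂ ∷ p₃ ∷ []) → All P (p₁ ∷ p₂ ∷ p₃ ∷ []) →
                          ∀ u a → ∃ λ z → P z × z ≢ u × z ≢ a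
  one-of-three-avoiding {p₁ = p₁} {p₂} {p₃} ((p₁≢p₂ ∷ p₁≢p₃ ∷ []) ∷ (p₂≢p₃ ∷ []) ∷ [] ∷ []) (P₁ ∷ P₂ ∷ P₃ ∷ []) u a
    with p₁ ≟ u | p₁ ≟ a | p₂ ≟ u | p₂ ≟ a
  ... | no p₁≢u  | no p₁≢a  | _        | _        = p₁ , P₁ , p₁≢u , p₁≢a
  ... | yes refl | _        | _        | yes refl = p₃ , P₃ , ≢-sym p₁≢p₃ , ≢-sym p₂≢p₃
  ... | yes refl | _        | _        | no p₂≢a  = p₂ , P₂ , ≢-sym p₁≢p₂ , p₂≢a
  ... | no _     | yes refl | yes refl | _        = p₃ , P₃ , ≢-sym p₂≢p₃ , ≢-sym p₁≢p₃
  ... | no _     | yes refl | no p₂≢u  | _        = p₂ , P₂ , p₂≢u , ≢-sym p₁≢p₂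

module _ {A : Set} where

  first-three : ∀ {P : A → Set} (ys : List A) → 3 ≤ length ys → Unique ys → All P ys →
                ∃₂ λ x x′ → ∃ λ x″ → Unique (x ∷ x′ ∷ x″ ∷ []) × P x × P x′ × P x″
  first-three (x ∷ x′ ∷ x″ ∷ _) _ ((x≢x′ ∷ x≢x″ ∷ _) ∷ (x′≢x″ ∷ _) ∷ _) (Px ∷ Px′ ∷ Px″ ∷ _) =
    x , x′ , x″ , (x≢x′ ∷ x≢x″ ∷ []) ∷ (x′≢x″ ∷ []) ∷ [] ∷ [] , Px , Px′ , Px″
  first-three []           ()                _ _
  first-three (_ ∷ [])     (s≤s ())          _ _
  first-three (_ ∷ _ ∷ []) (s≤s (s≤s ()))    _ _

  module _ (f : A → ℤ₃) where

    valued : ∀ κ → List A → List A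
    valued κ = filter (λ x → f x ≟ κ)

    length-by-value : ∀ xs → length xs ≡ length (valued 0F xs) + length (valued 1F xs) + length (valued 2F xs)
    length-by-value []       = refl
    length-by-value (x ∷ xs) = trans (cong suc (length-by-value xs)) (step (f x) refl)
      where
      a b c : ℕ
      a = length (valued 0F xs)
      b = length (valued 1F xs)
      c = length (valued 2F xs)
      P? : ∀ κ (y : A) → Dec (f y ≡ κ)
      P? κ y = f y ≟ κ
      lengths : ∀ {l₀ l₁ l₂} → valued 0F (x ∷ xs) ≡ l₀ → valued 1F (x ∷ xs) ≡ l₁ → valued 2F (x ∷ xs) ≡ l₂ →
                length (valued 0F (x ∷ xs)) + length (valued 1F (x ∷ xs)) + length (valued 2F (x ∷ xs)) ≡
                length l₀ + length l₁ + length l₂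
      lengths e₀ e₁ e₂ = cong₂ _+_ (cong₂ _+_ (cong length e₀) (cong length e₁)) (cong length e₂)
      step : ∀ κ → f x ≡ κ → suc (a + b + c) ≡
             length (valued 0F (x ∷ xs)) + length (valued 1F (x ∷ xs)) + length (valued 2F (x ∷ xs))
      step 0F fx = sym (lengths (List.filter-accept (P? 0F) fx)
                                (List.filter-reject (P? 1F) (λ fx≡1 → contradiction (trans (sym fx) fx≡1) λ ()))
                                (List.filter-reject (P? 2F) (λ fx≡2 → contradiction (trans (sym fx) fx≡2) λ ())))
      step 1F fx = trans (cong (_+ c) (sym (ℕ.+-suc a b)))
                         (sym (lengths (List.filter-reject (P? 0F) (λ fx≡0 → contradiction (trans (sym fx) fx≡0) λ ()))
                                       (List.filter-accept (P? 1F) fx)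
                                       (List.filter-reject (P? 2F) (λ fx≡2 → contradiction (trans (sym fx) fx≡2) λ ()))))
      step 2F fx = trans (sym (ℕ.+-suc (a + b) c))
                         (sym (lengths (List.filter-reject (P? 0F) (λ fx≡0 → contradiction (trans (sym fx) fx≡0) λ ()))
                                       (List.filter-reject (P? 1F) (λ fx≡1 → contradiction (trans (sym fx) fx≡1) λ ()))
                                       (List.filter-accept (P? 2F) fx)))

    three-of-value : ∀ {xs} κ → Unique xs → 3 ≤ length (valued κ xs) →
                     ∃₂ λ x x′ → ∃ λ x″ → Unique (x ∷ x′ ∷ x″ ∷ []) × f x′ ≡ f x × f x″ ≡ f x
    three-of-value {xs} κ distinct 3≤
      with first-three (valued κ xs) 3≤ (filter⁺ (λ x → f x ≟ κ) distinct) (all-filter (λ x → f x ≟ κ) xs)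
    ... | x , x′ , x″ , distinct′ , fx , fx′ , fx″ = x , x′ , x″ , distinct′ , trans fx′ (sym fx) , trans fx″ (sym fx)

    three-alike : ∀ xs → Unique xs → 7 ≤ length xs →
                  ∃₂ λ x x′ → ∃ λ x″ → Unique (x ∷ x′ ∷ x″ ∷ []) × f x′ ≡ f x × f x″ ≡ f x
    three-alike xs distinct 7≤|xs|
      with 3 ℕ.≤? length (valued 0F xs) | 3 ℕ.≤? length (valued 1F xs) | 3 ℕ.≤? length (valued 2F xs)
    ... | yes 3≤ | _      | _      = three-of-value 0F distinct 3≤
    ... | no _   | yes 3≤ | _      = three-of-value 1F distinct 3≤
    ... | no _   | no _   | yes 3≤ = three-of-value 2F distinct 3≤
    ... | no ≰₀  | no ≰₁  | no ≰₂  = contradiction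
      (ℕ.≤-trans 7≤|xs| (subst (_≤ 6) (sym (length-by-value xs))
        (ℕ.+-mono-≤ (ℕ.+-mono-≤ (ℕ.≤-pred (ℕ.≰⇒> ≰₀)) (ℕ.≤-pred (ℕ.≰⇒> ≰₁))) (ℕ.≤-pred (ℕ.≰⇒> ≰₂)))))
      (ℕ.<⇒≱ (ℕ.n<1+n 6))

centreˡ : ∀ d₁ d₂ → Fin (suc d₁ + suc d₂)
centreˡ d₁ d₂ = zero ↑ˡ suc d₂

leafˡ : ∀ d₁ d₂ → Fin d₁ → Fin (suc d₁ + suc d₂)
leafˡ d₁ d₂ i = suc i ↑ˡ suc d₂

centreʳ : ∀ d₁ d₂ → Fin (suc d₁ + suc d₂)
centreʳ d₁ d₂ = suc d₁ ↑ʳ zero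

leafʳ : ∀ d₁ d₂ → Fin d₂ → Fin (suc d₁ + suc d₂)
leafʳ d₁ d₂ j = suc d₁ ↑ʳ suc j

copySum-S : ∀ {N d₁ d₂} (χ : Coloring N) (f : Fin (V (S d₁ d₂)) → Fin N) →
  copySum (S d₁ d₂) χ f ≡ toℕ (∑[ i ∈ allFin d₁ ] χ (f (centreˡ d₁ d₂)) (f (leafˡ d₁ d₂ i)) ⊕
                                ∑[ j ∈ allFin d₂ ] χ (f (centreʳ d₁ d₂)) (f (leafʳ d₁ d₂ j)))
copySum-S {N} {d₁} {d₂} χ f = begin
  sum (map (λ { (a , b) → toℕ (χ (f a) (f b)) }) (E₁ ++ E₂)) % 3
    ≡⟨ cong (λ xs → sum xs % 3) (List.map-cong (λ { (a , b) → refl }) (E₁ ++ E₂)) ⟩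
  sum (map (toℕ ∘ colour) (E₁ ++ E₂)) % 3   ≡⟨ sum-toℕ-%3 (E₁ ++ E₂) colour ⟩
  toℕ (∑ (E₁ ++ E₂) colour)                 ≡⟨ cong toℕ (∑-++ E₁ E₂ colour) ⟩
  toℕ (∑ E₁ colour ⊕ ∑ E₂ colour)           ≡⟨ cong₂ (λ a b → toℕ (a ⊕ b)) (∑-map _ (allFin d₁) colour) (∑-map _ (allFin d₂) colour) ⟩
  toℕ (∑[ i ∈ allFin d₁ ] χ (f (centreˡ d₁ d₂)) (f (leafˡ d₁ d₂ i)) ⊕
       ∑[ j ∈ allFin d₂ ] χ (f (centreʳ d₁ d₂)) (f (leafʳ d₁ d₂ j))) ∎
  where
  open ≡-Reasoning
  colour : Fin (V (S d₁ d₂)) × Fin (V (S d₁ d₂)) → ℤ₃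
  colour (a , b) = χ (f a) (f b)
  E₁ E₂ : List (Fin (V (S d₁ d₂)) × Fin (V (S d₁ d₂)))
  E₁ = map (λ i → centreˡ d₁ d₂ , leafˡ d₁ d₂ i) (allFin d₁)
  E₂ = map (λ j → centreʳ d₁ d₂ , leafʳ d₁ d₂ j) (allFin d₂)

record ZeroSumStars {N : ℕ} (χ : Coloring N) (d₁ d₂ : ℕ) : Set where
  field
    centre₁ centre₂ : Fin N
    leaves₁ leaves₂ : List (Fin N)
    distinct        : Unique ((centre₁ ∷ leaves₁) ++ (centre₂ ∷ leaves₂))
    length₁         : length leaves₁ ≡ d₁
    length₂         : length leaves₂ ≡ d₂
    zero-sum        : ∑ leaves₁ (χ centre₁) ⊕ ∑ leaves₂ (χ centre₂) ≡ 0F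

module _ {N : ℕ} (χ : Coloring N) where

  stars-embedding : (c₁ : Fin N) (L₁ : List (Fin N)) (c₂ : Fin N) (L₂ : List (Fin N)) →
                    Fin (V (S (length L₁) (length L₂))) → Fin N
  stars-embedding c₁ L₁ c₂ L₂ = [ lookup (c₁ ∷ L₁) , lookup (c₂ ∷ L₂) ]′ ∘ splitAt (suc (length L₁))

  stars-embedding-injective : ∀ c₁ L₁ c₂ L₂ → Unique ((c₁ ∷ L₁) ++ (c₂ ∷ L₂)) →
                              Injective _≡_ _≡_ (stars-embedding c₁ L₁ c₂ L₂)
  stars-embedding-injective c₁ L₁ c₂ L₂ u {i} {j} e = begin
    i                                    ≡⟨ join-splitAt m n i ⟨
    join m n (splitAt m i)               ≡⟨ cong (join m n) (halves-injective {splitAt m i} {splitAt m j} e) ⟩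
    join m n (splitAt m j)               ≡⟨ join-splitAt m n j ⟩
    j                                    ∎
    where
    open ≡-Reasoning
    m n : ℕ
    m = suc (length L₁)
    n = suc (length L₂)
    halves-injective : ∀ {p q} → [ lookup (c₁ ∷ L₁) , lookup (c₂ ∷ L₂) ]′ p ≡ [ lookup (c₁ ∷ L₁) , lookup (c₂ ∷ L₂) ]′ q → p ≡ q
    halves-injective {inj₁ a} {inj₁ b} e = cong inj₁ (lookup-injective (Unique-++⁻ˡ (c₁ ∷ L₁) u) e)
    halves-injective {inj₂ a} {inj₂ b} e = cong inj₂ (lookup-injective (Unique-++⁻ʳ (c₁ ∷ L₁) u) e)
    halves-injective {inj₁ a} {inj₂ b} e = contradiction e (Unique-++⇒disjoint (c₁ ∷ L₁) u (∈-lookup a) (∈-lookup b))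
    halves-injective {inj₂ a} {inj₁ b} e = contradiction (sym e) (Unique-++⇒disjoint (c₁ ∷ L₁) u (∈-lookup b) (∈-lookup a))

  copySum-stars-embedding : ∀ c₁ L₁ c₂ L₂ →
    copySum (S (length L₁) (length L₂)) χ (stars-embedding c₁ L₁ c₂ L₂) ≡ toℕ (∑ L₁ (χ c₁) ⊕ ∑ L₂ (χ c₂))
  copySum-stars-embedding c₁ L₁ c₂ L₂ = trans (copySum-S χ f) (cong toℕ (cong₂ _⊕_ first-star second-star))
    where
    m n : ℕ
    m = suc (length L₁)
    n = suc (length L₂)
    f : Fin (V (S (length L₁) (length L₂))) → Fin N
    f = stars-embedding c₁ L₁ c₂ L₂
    on-halves : ∀ {i p} → splitAt m i ≡ p → f i ≡ [ lookup (c₁ ∷ L₁) , lookup (c₂ ∷ L₂) ]′ p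
    on-halves = cong [ lookup (c₁ ∷ L₁) , lookup (c₂ ∷ L₂) ]′
    first-star : ∑[ i ∈ allFin (length L₁) ] χ (f (centreˡ _ _)) (f (leafˡ _ _ i)) ≡ ∑ L₁ (χ c₁)
    first-star = trans (∑-cong (allFin (length L₁)) (λ {i} _ → cong (χ c₁) (on-halves (splitAt-↑ˡ m (suc i) n))))
                       (∑-lookup L₁ (χ c₁))
    second-star : ∑[ j ∈ allFin (length L₂) ] χ (f (centreʳ _ _)) (f (leafʳ _ _ j)) ≡ ∑ L₂ (χ c₂)
    second-star = trans (∑-cong (allFin (length L₂)) (λ {j} _ → cong₂ χ (on-halves (splitAt-↑ʳ m n zero))
                                                                       (on-halves (splitAt-↑ʳ m n (suc j)))))
                        (∑-lookup L₂ (χ c₂))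

  zero-sum-copy : ∀ {d₁ d₂} → ZeroSumStars χ d₁ d₂ →
                  Σ (Fin (V (S d₁ d₂)) → Fin N) λ f → Injective _≡_ _≡_ f × copySum (S d₁ d₂) χ f ≡ 0
  zero-sum-copy record { centre₁ = c₁ ; centre₂ = c₂ ; leaves₁ = L₁ ; leaves₂ = L₂
                       ; distinct = u ; length₁ = refl ; length₂ = refl ; zero-sum = z } =
    stars-embedding c₁ L₁ c₂ L₂ , stars-embedding-injective c₁ L₁ c₂ L₂ u ,
    trans (copySum-stars-embedding c₁ L₁ c₂ L₂) (cong toℕ z)

  swap-stars : ∀ {d₁ d₂} → ZeroSumStars χ d₁ d₂ → ZeroSumStars χ d₂ d₁
  swap-stars P = record
    { centre₁ = centre₂ ; centre₂ = centre₁ ; leaves₁ = leaves₂ ; leaves₂ = leaves₁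
    ; distinct = Unique-resp-↭ (++-comm (centre₁ ∷ leaves₁) (centre₂ ∷ leaves₂)) distinct
    ; length₁ = length₂ ; length₂ = length₁
    ; zero-sum = trans (⊕-comm (∑ leaves₂ (χ centre₂)) (∑ leaves₁ (χ centre₁))) zero-sum }
    where open ZeroSumStars P

-- Erdős–Ginzburg–Ziv for ℤ₃, and moving leaves between the two stars

module _ {A : Set} where

  Selection : ℕ → List A → Set
  Selection k xs = ∃₂ λ ys zs → Interleaving ys zs xs × length ys ≡ k

  selections : ∀ k (xs : List A) → List (Selection k xs)
  selections zero    xs       = ([] , xs , nothing-selected xs , refl) ∷ []
    where
    nothing-selected : ∀ xs → Interleaving [] xs xs
    nothing-selected []       = []
    nothing-selected (x ∷ xs) = consʳ (nothing-selected xs)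
  selections (suc k) []       = []
  selections (suc k) (x ∷ xs) = map keep (selections k xs) ++ map skip (selections (suc k) xs)
    where
    keep : Selection k xs → Selection (suc k) (x ∷ xs)
    keep (ys , zs , i , l) = x ∷ ys , zs , consˡ i , cong suc l
    skip : Selection (suc k) xs → Selection (suc k) (x ∷ xs)
    skip (ys , zs , i , l) = ys , x ∷ zs , consʳ i , l

  selection-by-position : ∀ (xs : List A) {I R} → Interleaving I R (allFin (length xs)) →
                          xs ↭ map (lookup xs) I ++ map (lookup xs) R
  selection-by-position xs {I} {R} I⊎R = begin
    xs                                       ≡⟨ positions ⟨
    map (lookup xs) (allFin (length xs))     ↭⟨ map⁺ (lookup xs) (toPermutation I⊎R) ⟩
    map (lookup xs) (I ++ R)                 ≡⟨ List.map-++ (lookup xs) I R ⟩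
    map (lookup xs) I ++ map (lookup xs) R   ∎
    where
    open ↭.PermutationReasoning
    positions : map (lookup xs) (allFin (length xs)) ≡ xs
    positions = trans (List.map-tabulate (λ i → i) (lookup xs)) (List.tabulate-lookup xs)

ThreeSumTo : ℤ₃ → ℤ₃ → ℤ₃ → ℤ₃ → ℤ₃ → ℤ₃ → Set
ThreeSumTo t a b c d e = Any (λ s → ∑ (proj₁ s) (lookup (a ∷ b ∷ c ∷ d ∷ e ∷ [])) ≡ t) (selections 3 (allFin 5))

threeSumTo? : ∀ t a b c d e → Dec (ThreeSumTo t a b c d e)
threeSumTo? t a b c d e = Any.any? (λ s → ∑ (proj₁ s) (lookup (a ∷ b ∷ c ∷ d ∷ e ∷ [])) ≟ t) (selections 3 (allFin 5))

-- Opaque, since a `with` on a term mentioning them would otherwise re-run the exhaustive check.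
opaque
  five-have-zero-sum-triple : ∀ a b c d e → ThreeSumTo 0F a b c d e
  five-have-zero-sum-triple = from-yes (all? λ a → all? λ b → all? λ c → all? λ d → all? λ e →
    threeSumTo? 0F a b c d e)

  two-unequal-pairs-reach-everything : ∀ a b c d e t → a ≢ b → c ≢ d → ThreeSumTo t a b c d e
  two-unequal-pairs-reach-everything = from-yes (all? λ a → all? λ b → all? λ c → all? λ d → all? λ e → all? λ t →
    ¬? (a ≟ b) →-dec ¬? (c ≟ d) →-dec threeSumTo? t a b c d e)

module _ {A : Set} where

  three-of-five : ∀ (w : A → ℤ₃) {t} x₁ x₂ x₃ x₄ x₅ → ThreeSumTo t (w x₁) (w x₂) (w x₃) (w x₄) (w x₅) →
    ∃₂ λ s₁ s₂ → ∃₂ λ s₃ R → x₁ ∷ x₂ ∷ x₃ ∷ x₄ ∷ x₅ ∷ [] ↭ s₁ ∷ s₂ ∷ s₃ ∷ R × ∑ (s₁ ∷ s₂ ∷ s₃ ∷ []) w ≡ t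
  three-of-five w x₁ x₂ x₃ x₄ x₅ hit with Any.satisfied hit
  ... | (i₁ ∷ i₂ ∷ i₃ ∷ [] , R , I⊎R , refl) , ∑I≡t =
    lookup xs i₁ , lookup xs i₂ , lookup xs i₃ , map (lookup xs) R , selection-by-position xs I⊎R ,
    trans (∑-map (lookup xs) (i₁ ∷ i₂ ∷ i₃ ∷ []) w) (trans (∑-cong (i₁ ∷ i₂ ∷ i₃ ∷ []) (λ {i} _ → value i)) ∑I≡t)
    where
    xs : List A
    xs = x₁ ∷ x₂ ∷ x₃ ∷ x₄ ∷ x₅ ∷ []
    value : ∀ i → w (lookup xs i) ≡ lookup (w x₁ ∷ w x₂ ∷ w x₃ ∷ w x₄ ∷ w x₅ ∷ []) i
    value 0F = refl
    value 1F = refl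
    value 2F = refl
    value (suc (suc (suc zero))) = refl
    value (suc (suc (suc (suc zero)))) = refl
  three-of-five w x₁ x₂ x₃ x₄ x₅ hit | ([] , _ , _ , ()) , _
  three-of-five w x₁ x₂ x₃ x₄ x₅ hit | (_ ∷ [] , _ , _ , ()) , _
  three-of-five w x₁ x₂ x₃ x₄ x₅ hit | (_ ∷ _ ∷ [] , _ , _ , ()) , _
  three-of-five w x₁ x₂ x₃ x₄ x₅ hit | (_ ∷ _ ∷ _ ∷ _ ∷ _ , _ , _ , ()) , _

  zero-sum-subfamily : ∀ (w : A → ℤ₃) k (xs : List A) → 2 + k * 3 ≤ length xs →
    ∃₂ λ ys zs → xs ↭ ys ++ zs × length ys ≡ k * 3 × ∑ ys w ≡ 0F
  zero-sum-subfamily w zero xs _ = [] , xs , ↭-refl , refl , refl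
  zero-sum-subfamily w (suc k) (x₁ ∷ x₂ ∷ x₃ ∷ x₄ ∷ x₅ ∷ xs) (s≤s (s≤s (s≤s (s≤s (s≤s k*3≤|xs|)))))
    with three-of-five w {0F} x₁ x₂ x₃ x₄ x₅ (five-have-zero-sum-triple (w x₁) (w x₂) (w x₃) (w x₄) (w x₅))
  ... | s₁ , s₂ , s₃ , R , five↭ , ∑T with zero-sum-subfamily w k (R ++ xs) room
    where
    |R| : length R ≡ 2
    |R| = ℕ.suc-injective (ℕ.suc-injective (ℕ.suc-injective (sym (↭-length five↭))))
    room : 2 + k * 3 ≤ length (R ++ xs)
    room = subst (2 + k * 3 ≤_) (sym (trans (List.length-++ R) (cong (_+ length xs) |R|))) (s≤s (s≤s k*3≤|xs|))
  ... | ys , zs , rest↭ , |ys| , ∑ys =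
    T ++ ys , zs , perm , cong (3 +_) |ys| , trans (∑-++ T ys w) (cong₂ _⊕_ ∑T ∑ys)
    where
    T : List A
    T = s₁ ∷ s₂ ∷ s₃ ∷ []
    open ↭.PermutationReasoning
    perm : x₁ ∷ x₂ ∷ x₃ ∷ x₄ ∷ x₅ ∷ xs ↭ (T ++ ys) ++ zs
    perm = begin
      (x₁ ∷ x₂ ∷ x₃ ∷ x₄ ∷ x₅ ∷ []) ++ xs   ↭⟨ ++⁺ʳ xs five↭ ⟩
      (T ++ R) ++ xs                       ≡⟨ List.++-assoc T R xs ⟩
      T ++ (R ++ xs)                       ↭⟨ ++⁺ˡ T rest↭ ⟩
      T ++ (ys ++ zs)                      ≡⟨ List.++-assoc T ys zs ⟨
      (T ++ ys) ++ zs                      ∎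
  zero-sum-subfamily w (suc k) [] ()
  zero-sum-subfamily w (suc k) (_ ∷ []) (s≤s ())
  zero-sum-subfamily w (suc k) (_ ∷ _ ∷ []) (s≤s (s≤s ()))
  zero-sum-subfamily w (suc k) (_ ∷ _ ∷ _ ∷ []) (s≤s (s≤s (s≤s ())))
  zero-sum-subfamily w (suc k) (_ ∷ _ ∷ _ ∷ _ ∷ []) (s≤s (s≤s (s≤s (s≤s ()))))

module _ {N : ℕ} (χ : Coloring N) where

  -- The 3k leaves handed from the second star to the first have zero sum of χ c₁ − χ c₂ (EGZ),
  -- so the weight does not change.
  lift-stars : ∀ {s d} k → 2 ≤ d → ZeroSumStars χ s (k * 3 + d) → ZeroSumStars χ (s + k * 3) d
  lift-stars {s} {d} k 2≤d P
    with zero-sum-subfamily (λ y → χ centre₁ y ⊖ χ centre₂ y) k leaves₂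
           (subst (_≤ length leaves₂) (ℕ.+-comm (k * 3) 2) (subst (k * 3 + 2 ≤_) (sym length₂) (ℕ.+-monoʳ-≤ (k * 3) 2≤d)))
    where open ZeroSumStars P
  ... | M , L , leaves₂↭ , |M| , ∑M = record
    { centre₁ = centre₁ ; centre₂ = centre₂ ; leaves₁ = leaves₁ ++ M ; leaves₂ = L
    ; distinct = Unique-resp-↭ perm distinct
    ; length₁  = trans (List.length-++ leaves₁) (cong₂ _+_ length₁ |M|)
    ; length₂  = ℕ.+-cancelˡ-≡ (k * 3) (length L) d (trans (cong (_+ length L) (sym |M|))
                   (trans (sym (List.length-++ M)) (trans (sym (↭-length leaves₂↭)) length₂)))
    ; zero-sum = trans weight-unchanged zero-sum }
    where
    open ZeroSumStars P
    c₁ c₂ : Fin N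
    c₁ = centre₁
    c₂ = centre₂
    perm : (c₁ ∷ leaves₁) ++ (c₂ ∷ leaves₂) ↭ (c₁ ∷ leaves₁ ++ M) ++ (c₂ ∷ L)
    perm = begin
      c₁ ∷ leaves₁ ++ c₂ ∷ leaves₂        ↭⟨ ++⁺ˡ (c₁ ∷ leaves₁) (↭-prep c₂ leaves₂↭) ⟩
      c₁ ∷ leaves₁ ++ c₂ ∷ M ++ L         ↭⟨ ++⁺ˡ (c₁ ∷ leaves₁) (↭-sym (shift c₂ M L)) ⟩
      c₁ ∷ leaves₁ ++ M ++ c₂ ∷ L         ≡⟨ cong (c₁ ∷_) (List.++-assoc leaves₁ M (c₂ ∷ L)) ⟨
      c₁ ∷ (leaves₁ ++ M) ++ c₂ ∷ L       ∎
      where open ↭.PermutationReasoning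
    moved-leaves : ∑ M (χ c₁) ≡ ∑ M (χ c₂)
    moved-leaves = begin
      ∑ M (χ c₁)                                          ≡⟨ ∑-cong M (λ {y} _ → split (χ c₁ y) (χ c₂ y)) ⟩
      ∑[ y ∈ M ] ((χ c₁ y ⊖ χ c₂ y) ⊕ χ c₂ y)              ≡⟨ ∑-⊕ M (λ y → χ c₁ y ⊖ χ c₂ y) (χ c₂) ⟩
      ∑[ y ∈ M ] (χ c₁ y ⊖ χ c₂ y) ⊕ ∑ M (χ c₂)            ≡⟨ cong (_⊕ ∑ M (χ c₂)) ∑M ⟩
      0F ⊕ ∑ M (χ c₂)                                     ≡⟨⟩
      ∑ M (χ c₂)                                          ∎
      where
      open ≡-Reasoning
      split : ∀ a b → a ≡ (a ⊖ b) ⊕ b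
      split = from-yes (all? λ a → all? λ b → a ≟ (a ⊖ b) ⊕ b)
    weight-unchanged : ∑ (leaves₁ ++ M) (χ c₁) ⊕ ∑ L (χ c₂) ≡ ∑ leaves₁ (χ c₁) ⊕ ∑ leaves₂ (χ c₂)
    weight-unchanged = begin
      ∑ (leaves₁ ++ M) (χ c₁) ⊕ ∑ L (χ c₂)                ≡⟨ cong (_⊕ ∑ L (χ c₂)) (∑-++ leaves₁ M (χ c₁)) ⟩
      ∑ leaves₁ (χ c₁) ⊕ ∑ M (χ c₁) ⊕ ∑ L (χ c₂)          ≡⟨ cong (λ a → ∑ leaves₁ (χ c₁) ⊕ a ⊕ ∑ L (χ c₂)) moved-leaves ⟩
      ∑ leaves₁ (χ c₁) ⊕ ∑ M (χ c₂) ⊕ ∑ L (χ c₂)          ≡⟨ ⊕-assoc (∑ leaves₁ (χ c₁)) _ _ ⟩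
      ∑ leaves₁ (χ c₁) ⊕ (∑ M (χ c₂) ⊕ ∑ L (χ c₂))        ≡⟨ cong (∑ leaves₁ (χ c₁) ⊕_) (∑-++ M L (χ c₂)) ⟨
      ∑ leaves₁ (χ c₁) ⊕ ∑ (M ++ L) (χ c₂)                ≡⟨ cong (∑ leaves₁ (χ c₁) ⊕_) (∑-↭ (χ c₂) (↭-sym leaves₂↭)) ⟩
      ∑ leaves₁ (χ c₁) ⊕ ∑ leaves₂ (χ c₂)                 ∎
      where open ≡-Reasoning

module _ {N : ℕ} (χ : Coloring N) where

  -- The colour of the diagonal pair (v, v) is meaningless and is cancelled out.
  deg : Fin N → ℤ₃
  deg v = ∑ (allFin N) (χ v) ⊖ χ v v

  deg-↭ : ∀ {v zs} → allFin N ↭ v ∷ zs → deg v ≡ ∑ zs (χ v)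
  deg-↭ {v} {zs} all↭ = trans (cong (_⊖ χ v v) (∑-↭ (χ v) all↭)) (cancel (χ v v) (∑ zs (χ v)))
    where
    cancel : ∀ a b → a ⊕ b ⊖ a ≡ b
    cancel = from-yes (all? λ a → all? λ b → a ⊕ b ⊖ a ≟ b)

  deg-except : ∀ v (M : List (Fin N)) c → Unique (v ∷ M) → (∀ {w} → w ≢ v → w ∉ M → χ v w ≡ c) →
               deg v ≡ ∑ M (χ v) ⊕ ([ N ]₃ ⊖ [ suc (length M) ]₃) ⊗ c
  deg-except v M c distinct elsewhere with complement distinct
  ... | R , all↭ = begin
    deg v                                                 ≡⟨ deg-↭ all↭ ⟩
    ∑ (M ++ R) (χ v)                                      ≡⟨ ∑-++ M R (χ v) ⟩
    ∑ M (χ v) ⊕ ∑ R (χ v)                                 ≡⟨ cong (∑ M (χ v) ⊕_) (∑-cong R (λ w∈R → elsewhere (v≢ w∈R) (∉M w∈R))) ⟩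
    ∑ M (χ v) ⊕ ∑[ w ∈ R ] c                              ≡⟨ cong (∑ M (χ v) ⊕_) (∑-const R c) ⟩
    ∑ M (χ v) ⊕ [ length R ]₃ ⊗ c                         ≡⟨ cong (λ r → ∑ M (χ v) ⊕ r ⊗ c) ([length-complement]₃ {xs = v ∷ M} {zs = R} all↭) ⟩
    ∑ M (χ v) ⊕ ([ N ]₃ ⊖ [ suc (length M) ]₃) ⊗ c        ∎
    where
    open ≡-Reasoning
    v≢ : ∀ {w} → w ∈ R → w ≢ v
    v≢ = complement-≢ (v ∷ M) all↭ (here refl)
    ∉M : ∀ {w} → w ∈ R → w ∉ M
    ∉M w∈R w∈M = complement-≢ (v ∷ M) all↭ (there w∈M) w∈R refl

  stars-on-complement : ∀ u v (S Z : List (Fin N)) {m} → Unique (Z ++ u ∷ S ++ v ∷ []) →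
    length (Z ++ u ∷ S ++ v ∷ []) + m ≡ N →
    ∑ S (χ u) ⊕ (deg v ⊖ χ v u ⊖ ∑ S (χ v) ⊖ ∑ Z (χ v)) ≡ 0F → ZeroSumStars χ (length S) m
  stars-on-complement u v S Z {m} distinct |xs|+m≡N weight with complement distinct
  ... | R , all↭ = record
    { centre₁ = u ; centre₂ = v ; leaves₁ = S ; leaves₂ = R
    ; distinct = Unique-++⁻ʳ Z (subst Unique regroup (Unique-resp-↭ all↭ (allFin⁺ N)))
    ; length₁  = refl
    ; length₂  = ℕ.+-cancelˡ-≡ (length xs) (length R) m (trans |xs++R|≡N (sym |xs|+m≡N))
    ; zero-sum = trans (cong (∑ S (χ u) ⊕_) ∑R) weight }
    where
    xs : List (Fin N)
    xs = Z ++ u ∷ S ++ v ∷ []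
    regroup : xs ++ R ≡ Z ++ u ∷ S ++ v ∷ R
    regroup = trans (List.++-assoc Z (u ∷ S ++ v ∷ []) R) (cong (λ ys → Z ++ u ∷ ys) (List.++-assoc S (v ∷ []) R))
    |xs++R|≡N : length xs + length R ≡ N
    |xs++R|≡N = trans (sym (List.length-++ xs)) (trans (sym (↭-length all↭)) (List.length-tabulate (λ i → i)))
    v-first : allFin N ↭ v ∷ (Z ++ u ∷ S) ++ R
    v-first = begin
      allFin N                   ↭⟨ all↭ ⟩
      xs ++ R                    ≡⟨ trans (cong (_++ R) (sym (List.++-assoc Z (u ∷ S) (v ∷ []))))
                                             (List.++-assoc (Z ++ u ∷ S) (v ∷ []) R) ⟩
      (Z ++ u ∷ S) ++ v ∷ R      ↭⟨ shift v (Z ++ u ∷ S) R ⟩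
      v ∷ (Z ++ u ∷ S) ++ R      ∎
      where open ↭.PermutationReasoning
    ∑R : ∑ R (χ v) ≡ deg v ⊖ χ v u ⊖ ∑ S (χ v) ⊖ ∑ Z (χ v)
    ∑R = begin
      ∑ R (χ v)                                                    ≡⟨ rearrange (∑ Z (χ v)) (χ v u) (∑ S (χ v)) (∑ R (χ v)) ⟩
      ∑ Z (χ v) ⊕ (χ v u ⊕ ∑ S (χ v)) ⊕ ∑ R (χ v) ⊖ χ v u ⊖ ∑ S (χ v) ⊖ ∑ Z (χ v)
                                                                   ≡⟨ cong (λ d → d ⊖ χ v u ⊖ ∑ S (χ v) ⊖ ∑ Z (χ v)) deg-split ⟨
      deg v ⊖ χ v u ⊖ ∑ S (χ v) ⊖ ∑ Z (χ v)                        ∎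
      where
      open ≡-Reasoning
      rearrange : ∀ z a s r → r ≡ z ⊕ (a ⊕ s) ⊕ r ⊖ a ⊖ s ⊖ z
      rearrange = from-yes (all? λ z → all? λ a → all? λ s → all? λ r → r ≟ z ⊕ (a ⊕ s) ⊕ r ⊖ a ⊖ s ⊖ z)
      deg-split : deg v ≡ ∑ Z (χ v) ⊕ (χ v u ⊕ ∑ S (χ v)) ⊕ ∑ R (χ v)
      deg-split = trans (deg-↭ v-first) (trans (∑-++ (Z ++ u ∷ S) R (χ v)) (cong (_⊕ ∑ R (χ v)) (∑-++ Z (u ∷ S) (χ v))))

-- N ≡ 0 (mod 3): a zero-sum S(1, N − 4)

module ZeroSumS₁ {N : ℕ} (χ : Coloring N) (χ-sym : Symmetric χ) ([N]₃≡0 : [ N ]₃ ≡ 0F) (6≤N : 6 ≤ N) where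

  fresh′ : ∀ (xs : List (Fin N)) {_ : True (length xs ℕ.<? 6)} → ∃ λ y → All (y ≢_) xs
  fresh′ = fresh-below 6≤N

  -- χ v z ≡ ρ v u a says that the star u–a together with the star at v on all vertices except
  -- u, a, z is a zero-sum S(1, N − 4).
  ρ : Fin N → Fin N → Fin N → ℤ₃
  ρ v u a = χ u a ⊕ deg χ v ⊖ χ v u ⊖ χ v a

  zero-sum-stars : ∀ {v u a z m} → Unique (z ∷ u ∷ a ∷ v ∷ []) → χ v z ≡ ρ v u a → 4 + m ≡ N → ZeroSumStars χ 1 m
  zero-sum-stars {v} {u} {a} {z} distinct hit 4+m≡N =
    stars-on-complement χ u v (a ∷ []) (z ∷ []) distinct 4+m≡N
      (balance (χ u a) (deg χ v) (χ v u) (χ v a) (χ v z) hit)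
    where
    balance : ∀ p D q r s → s ≡ p ⊕ D ⊖ q ⊖ r → p ⊕ 0F ⊕ (D ⊖ q ⊖ (r ⊕ 0F) ⊖ (s ⊕ 0F)) ≡ 0F
    balance = from-yes (all? λ p → all? λ D → all? λ q → all? λ r → all? λ s →
      s ≟ p ⊕ D ⊖ q ⊖ r →-dec p ⊕ 0F ⊕ (D ⊖ q ⊖ (r ⊕ 0F) ⊖ (s ⊕ 0F)) ≟ 0F)

  deg-almost-monochromatic : ∀ {x y c} → x ≢ y → (∀ {w} → w ≢ x → w ≢ y → χ x w ≡ c) → deg χ x ≡ χ x y ⊕ c
  deg-almost-monochromatic {x} {y} {c} x≢y elsewhere = begin
    deg χ x                                          ≡⟨ deg-except χ x (y ∷ []) c ((x≢y ∷ []) ∷ [] ∷ [])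
                                                          (λ w≢x w∉y → elsewhere w≢x (w∉y ∘ here)) ⟩
    χ x y ⊕ 0F ⊕ ([ N ]₃ ⊖ [ 2 ]₃) ⊗ c               ≡⟨ cong (λ n → χ x y ⊕ 0F ⊕ (n ⊖ [ 2 ]₃) ⊗ c) [N]₃≡0 ⟩
    χ x y ⊕ 0F ⊕ (0F ⊖ [ 2 ]₃) ⊗ c                   ≡⟨ from-yes (all? λ p → all? λ c → p ⊕ 0F ⊕ (0F ⊖ [ 2 ]₃) ⊗ c ≟ p ⊕ c) (χ x y) c ⟩
    χ x y ⊕ c                                        ∎
    where open ≡-Reasoning

  module NoZeroSumCopy (forbidden : ∀ {v u a z} → Unique (z ∷ u ∷ a ∷ v ∷ []) → χ v z ≢ ρ v u a) where

    no-three-colours : ∀ {v x y w} → Unique (v ∷ x ∷ y ∷ w ∷ []) →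
                       χ v x ≢ χ v y → χ v x ≢ χ v w → χ v y ≢ χ v w → ⊥
    no-three-colours {v} {x} {y} {w} ((v≢x ∷ v≢y ∷ v≢w ∷ []) ∷ _) xy xw yw
      with fresh′ (v ∷ x ∷ y ∷ w ∷ [])
    ... | u , u≢v ∷ u≢x ∷ u≢y ∷ u≢w ∷ [] with fresh′ (v ∷ x ∷ y ∷ w ∷ u ∷ [])
    ... | a , a≢v ∷ a≢x ∷ a≢y ∷ a≢w ∷ a≢u ∷ [] with three-values-cover (ρ v u a) xy xw yw
    ... | inj₁ ρ≡ = forbidden (distinct₄ (≢-sym u≢x) (≢-sym a≢x) (≢-sym v≢x) (≢-sym a≢u) u≢v a≢v) (sym ρ≡)
    ... | inj₂ (inj₁ ρ≡) = forbidden (distinct₄ (≢-sym u≢y) (≢-sym a≢y) (≢-sym v≢y) (≢-sym a≢u) u≢v a≢v) (sym ρ≡)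
    ... | inj₂ (inj₂ ρ≡) = forbidden (distinct₄ (≢-sym u≢w) (≢-sym a≢w) (≢-sym v≢w) (≢-sym a≢u) u≢v a≢v) (sym ρ≡)

    two-colours : ∀ {v x y w} → x ≢ v → y ≢ v → w ≢ v → χ v x ≢ χ v y → χ v w ≢ χ v y → χ v w ≡ χ v x
    two-colours {v} {x} {y} {w} x≢v y≢v w≢v xy wy with w ≟ x | χ v w ≟ χ v x
    ... | yes refl | _       = refl
    ... | no _     | yes wx  = wx
    ... | no w≢x   | no  wx  = ⊥-elim (no-three-colours
                    (distinct₄ (≢-sym x≢v) (≢-sym y≢v) (≢-sym w≢v) (λ x≡y → xy (cong (χ v) x≡y)) (≢-sym w≢x)
                               (λ y≡w → wy (cong (χ v) (sym y≡w))))
                    xy (≢-sym wx) (≢-sym wy))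

    ρ-forced : ∀ {v u a z₁ z₂} → Unique (z₁ ∷ u ∷ a ∷ v ∷ []) → Unique (z₂ ∷ u ∷ a ∷ v ∷ []) →
               χ v z₁ ≢ χ v z₂ → ρ v u a ≡ ⊖ (χ v z₁ ⊕ χ v z₂)
    ρ-forced d₁ d₂ z₁z₂ = third-value z₁z₂ (≢-sym (forbidden d₁)) (≢-sym (forbidden d₂))

    almost-monochromatic : ∀ {x y c} → x ≢ y → (∀ {w} → w ≢ x → w ≢ y → χ x w ≡ c) →
                           ∀ {u a} → u ≢ x → u ≢ y → a ≢ x → a ≢ u → χ u a ≢ c
    almost-monochromatic {x} {y} {c} x≢y elsewhere {u} {a} u≢x u≢y a≢x a≢u χua≡c with a ≟ y
    ... | no a≢y = forbidden (distinct₄ (≢-sym u≢y) (≢-sym a≢y) (≢-sym x≢y) (≢-sym a≢u) u≢x a≢x) (sym (begin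
      χ u a ⊕ deg χ x ⊖ χ x u ⊖ χ x a              ≡⟨ cong₂ (λ p q → p ⊕ q ⊖ χ x u ⊖ χ x a) χua≡c (deg-almost-monochromatic x≢y elsewhere) ⟩
      c ⊕ (χ x y ⊕ c) ⊖ χ x u ⊖ χ x a              ≡⟨ cong₂ (λ p q → c ⊕ (χ x y ⊕ c) ⊖ p ⊖ q) (elsewhere u≢x u≢y) (elsewhere a≢x a≢y) ⟩
      c ⊕ (χ x y ⊕ c) ⊖ c ⊖ c                      ≡⟨ from-yes (all? λ p → all? λ c → c ⊕ (p ⊕ c) ⊖ c ⊖ c ≟ p) (χ x y) c ⟩
      χ x y                                        ∎))
      where open ≡-Reasoning
    ... | yes refl with fresh′ (x ∷ a ∷ u ∷ [])
    ...   | z , z≢x ∷ z≢a ∷ z≢u ∷ [] = forbidden (distinct₄ z≢u z≢a z≢x (≢-sym a≢u) u≢x a≢x) (begin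
      χ x z                                        ≡⟨ elsewhere z≢x z≢a ⟩
      c                                            ≡⟨ χua≡c ⟨
      χ u a                                        ≡⟨ from-yes (all? λ p → all? λ q → all? λ c → p ≟ p ⊕ (q ⊕ c) ⊖ c ⊖ q) (χ u a) (χ x a) c ⟩
      χ u a ⊕ (χ x a ⊕ c) ⊖ c ⊖ χ x a              ≡⟨ cong₂ (λ p q → χ u a ⊕ p ⊖ q ⊖ χ x a) (deg-almost-monochromatic x≢y elsewhere) (elsewhere u≢x u≢y) ⟨
      χ u a ⊕ deg χ x ⊖ χ x u ⊖ χ x a              ∎)
      where open ≡-Reasoning

    monochromatic-vertex : ∀ {v c} → (∀ {w} → w ≢ v → χ v w ≡ c) → ⊥
    monochromatic-vertex {v} {c} monochromatic with fresh′ (v ∷ [])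
    ... | v′ , v′≢v ∷ [] with fresh′ (v ∷ v′ ∷ [])
    ... | x , x≢v ∷ x≢v′ ∷ [] with fresh′ (v ∷ v′ ∷ x ∷ [])
    ... | a , a≢v ∷ a≢v′ ∷ a≢x ∷ [] =
      almost-monochromatic v′≢v v′-colours x≢v′ x≢v a≢v′ a≢x χxa≡d
      where
      avoids-c : ∀ {u b} → u ≢ v → b ≢ v → b ≢ u → χ u b ≢ c
      avoids-c {u} {b} u≢v b≢v b≢u with fresh′ (v ∷ u ∷ b ∷ [])
      ... | y , y≢v ∷ y≢u ∷ y≢b ∷ [] =
        almost-monochromatic (≢-sym y≢v) (λ w≢v _ → monochromatic w≢v) u≢v (≢-sym y≢u) b≢v b≢u
      χ-to-v : ∀ {u} → u ≢ v → χ u v ≡ c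
      χ-to-v u≢v = trans (χ-sym _ v) (monochromatic u≢v)
      d : ℤ₃
      d = χ v′ x
      v′-colours : ∀ {w} → w ≢ v′ → w ≢ v → χ v′ w ≡ d
      v′-colours {w} w≢v′ w≢v with w ≟ x
      ... | yes refl = refl
      ... | no w≢x = two-colours x≢v′ (≢-sym v′≢v) w≢v′ (λ χv′x≡χv′v → avoids-c v′≢v x≢v x≢v′ (trans χv′x≡χv′v (χ-to-v v′≢v)))
                                  (λ χv′w≡χv′v → avoids-c v′≢v w≢v w≢v′ (trans χv′w≡χv′v (χ-to-v v′≢v)))
      χxa≡d : χ x a ≡ d
      χxa≡d = trans (two-colours (≢-sym x≢v′) (≢-sym x≢v) a≢x
                      (λ χxv′≡χxv → avoids-c v′≢v x≢v x≢v′ (trans (χ-sym v′ x) (trans χxv′≡χxv (χ-to-v x≢v))))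
                      (λ χxa≡χxv → avoids-c x≢v a≢v a≢x (trans χxa≡χxv (χ-to-v x≢v))))
                    (χ-sym x v′)

    single-exception : ∀ {v y α β} → y ≢ v → α ≢ β → χ v y ≡ β → (∀ {w} → w ≢ v → w ≢ y → χ v w ≡ α) → ⊥
    single-exception {v} {y} {α} {β} y≢v α≢β χvy≡β elsewhere with fresh′ (v ∷ y ∷ [])
    ... | u₀ , u₀≢v ∷ u₀≢y ∷ [] with fresh′ (v ∷ y ∷ u₀ ∷ [])
    ... | a₁ , a₁≢v ∷ a₁≢y ∷ a₁≢u₀ ∷ [] with fresh′ (v ∷ y ∷ u₀ ∷ [])
    ... | u , u≢v ∷ u≢y ∷ u≢u₀ ∷ [] with fresh′ (v ∷ y ∷ u₀ ∷ u ∷ [])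
    ... | a , a≢v ∷ a≢y ∷ a≢u₀ ∷ a≢u ∷ [] =
      almost-monochromatic u₀≢v u₀-colours u≢u₀ u≢v a≢u₀ a≢u (edge-colour u≢v u≢y a≢v a≢y (≢-sym a≢u))
      where
      deg-v : deg χ v ≡ β ⊕ α
      deg-v = trans (deg-almost-monochromatic (≢-sym y≢v) elsewhere) (cong (_⊕ α) χvy≡β)
      edge-colour : ∀ {u a} → u ≢ v → u ≢ y → a ≢ v → a ≢ y → u ≢ a → χ u a ≡ β
      edge-colour {u} {a} u≢v u≢y a≢v a≢y u≢a with fresh′ (v ∷ y ∷ u ∷ a ∷ [])
      ... | z , z≢v ∷ z≢y ∷ z≢u ∷ z≢a ∷ [] = solve (begin
        χ u a ⊕ (β ⊕ α) ⊖ α ⊖ α                   ≡⟨ cong₂ (λ p q → χ u a ⊕ p ⊖ q ⊖ α) deg-v (elsewhere u≢v u≢y) ⟨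
        χ u a ⊕ deg χ v ⊖ χ v u ⊖ α               ≡⟨ cong (λ q → χ u a ⊕ deg χ v ⊖ χ v u ⊖ q) (elsewhere a≢v a≢y) ⟨
        ρ v u a                                   ≡⟨ ρ-forced (distinct₄ (≢-sym u≢y) (≢-sym a≢y) y≢v u≢a u≢v a≢v)
                                                               (distinct₄ z≢u z≢a z≢v u≢a u≢v a≢v)
                                                               (λ χvy≡χvz → α≢β (trans (sym (elsewhere z≢v z≢y)) (trans (sym χvy≡χvz) χvy≡β))) ⟩
        ⊖ (χ v y ⊕ χ v z)                         ≡⟨ cong₂ (λ p q → ⊖ (p ⊕ q)) χvy≡β (elsewhere z≢v z≢y) ⟩
        ⊖ (β ⊕ α)                                 ∎)
        where
        open ≡-Reasoning
        solve : χ u a ⊕ (β ⊕ α) ⊖ α ⊖ α ≡ ⊖ (β ⊕ α) → χ u a ≡ β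
        solve = from-yes (all? λ p → all? λ α → all? λ β → p ⊕ (β ⊕ α) ⊖ α ⊖ α ≟ ⊖ (β ⊕ α) →-dec p ≟ β) (χ u a) α β
      χu₀y≡β : χ u₀ y ≡ β
      χu₀y≡β = trans (two-colours a₁≢u₀ (≢-sym u₀≢v) (≢-sym u₀≢y)
                        (λ χu₀a₁≡χu₀v → α≢β (trans (sym (trans (χ-sym u₀ v) (elsewhere u₀≢v u₀≢y)))
                                                  (trans (sym χu₀a₁≡χu₀v) (edge-colour u₀≢v u₀≢y a₁≢v a₁≢y (≢-sym a₁≢u₀)))))
                        (λ χu₀y≡χu₀v → almost-monochromatic (≢-sym y≢v) elsewhere u₀≢v u₀≢y y≢v (≢-sym u₀≢y)
                                          (trans χu₀y≡χu₀v (trans (χ-sym u₀ v) (elsewhere u₀≢v u₀≢y)))))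
                     (edge-colour u₀≢v u₀≢y a₁≢v a₁≢y (≢-sym a₁≢u₀))
      u₀-colours : ∀ {w} → w ≢ u₀ → w ≢ v → χ u₀ w ≡ β
      u₀-colours {w} w≢u₀ w≢v with w ≟ y
      ... | yes refl = χu₀y≡β
      ... | no w≢y = edge-colour u₀≢v u₀≢y w≢v w≢y (≢-sym w≢u₀)

    two-exceptions : ∀ {v b₁ b₂ α β} → Unique (v ∷ b₁ ∷ b₂ ∷ []) → α ≢ β → χ v b₁ ≡ β → χ v b₂ ≡ β →
                     (∀ {w} → w ≢ v → w ≢ b₁ → w ≢ b₂ → χ v w ≡ α) → ⊥
    two-exceptions {v} {b₁} {b₂} {α} {β} ((v≢b₁ ∷ v≢b₂ ∷ []) ∷ (b₁≢b₂ ∷ []) ∷ [] ∷ []) α≢β χvb₁≡β χvb₂≡β elsewhere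
      with fresh′ (v ∷ b₁ ∷ b₂ ∷ [])
    ... | u , u≢v ∷ u≢b₁ ∷ u≢b₂ ∷ [] =
      almost-monochromatic b₁≢b₂ b₁-colours u≢b₁ u≢b₂ (≢-sym b₁≢b₂) (≢-sym u≢b₂)
        (towards-exception u≢v u≢b₂ u≢b₁ (≢-sym v≢b₂) (≢-sym v≢b₁) (≢-sym b₁≢b₂) χvb₂≡β χvb₁≡β
          (λ w≢v w≢b₂ w≢b₁ → elsewhere w≢v w≢b₁ w≢b₂))
      where
      deg-v : deg χ v ≡ β ⊕ β
      deg-v = begin
        deg χ v                                             ≡⟨ deg-except χ v (b₁ ∷ b₂ ∷ []) α ((v≢b₁ ∷ v≢b₂ ∷ []) ∷ (b₁≢b₂ ∷ []) ∷ [] ∷ [])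
                                                                 (λ w≢v w∉ → elsewhere w≢v (w∉ ∘ here) (w∉ ∘ there ∘ here)) ⟩
        χ v b₁ ⊕ (χ v b₂ ⊕ 0F) ⊕ ([ N ]₃ ⊖ [ 3 ]₃) ⊗ α      ≡⟨ cong (λ n → χ v b₁ ⊕ (χ v b₂ ⊕ 0F) ⊕ (n ⊖ [ 3 ]₃) ⊗ α) [N]₃≡0 ⟩
        χ v b₁ ⊕ (χ v b₂ ⊕ 0F) ⊕ (0F ⊖ [ 3 ]₃) ⊗ α          ≡⟨ cong₂ (λ p q → p ⊕ (q ⊕ 0F) ⊕ (0F ⊖ [ 3 ]₃) ⊗ α) χvb₁≡β χvb₂≡β ⟩
        β ⊕ (β ⊕ 0F) ⊕ (0F ⊖ [ 3 ]₃) ⊗ α                    ≡⟨ from-yes (all? λ α → all? λ β → β ⊕ (β ⊕ 0F) ⊕ (0F ⊖ [ 3 ]₃) ⊗ α ≟ β ⊕ β) α β ⟩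
        β ⊕ β                                               ∎
        where open ≡-Reasoning
      towards-exception : ∀ {u b b′} → u ≢ v → u ≢ b → u ≢ b′ → b ≢ v → b′ ≢ v → b ≢ b′ → χ v b ≡ β → χ v b′ ≡ β →
                          (∀ {w} → w ≢ v → w ≢ b → w ≢ b′ → χ v w ≡ α) → χ u b ≡ β
      towards-exception {u} {b} {b′} u≢v u≢b u≢b′ b≢v b′≢v b≢b′ χvb≡β χvb′≡β others with fresh′ (v ∷ b ∷ b′ ∷ u ∷ [])
      ... | z , z≢v ∷ z≢b ∷ z≢b′ ∷ z≢u ∷ [] = solve (begin
        χ u b ⊕ (β ⊕ β) ⊖ α ⊖ β                   ≡⟨ cong₂ (λ p q → χ u b ⊕ p ⊖ q ⊖ β) deg-v (others u≢v u≢b u≢b′) ⟨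
        χ u b ⊕ deg χ v ⊖ χ v u ⊖ β               ≡⟨ cong (λ q → χ u b ⊕ deg χ v ⊖ χ v u ⊖ q) χvb≡β ⟨
        ρ v u b                                   ≡⟨ ρ-forced (distinct₄ z≢u z≢b z≢v u≢b u≢v b≢v)
                                                               (distinct₄ (≢-sym u≢b′) (≢-sym b≢b′) b′≢v u≢b u≢v b≢v)
                                                               (λ χvz≡χvb′ → α≢β (trans (sym (others z≢v z≢b z≢b′)) (trans χvz≡χvb′ χvb′≡β))) ⟩
        ⊖ (χ v z ⊕ χ v b′)                        ≡⟨ cong₂ (λ p q → ⊖ (p ⊕ q)) (others z≢v z≢b z≢b′) χvb′≡β ⟩
        ⊖ (α ⊕ β)                                 ∎)
        where
        open ≡-Reasoning
        solve : χ u b ⊕ (β ⊕ β) ⊖ α ⊖ β ≡ ⊖ (α ⊕ β) → χ u b ≡ β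
        solve = from-yes (all? λ p → all? λ α → all? λ β → p ⊕ (β ⊕ β) ⊖ α ⊖ β ≟ ⊖ (α ⊕ β) →-dec p ≟ β) (χ u b) α β
      b₁-colours : ∀ {w} → w ≢ b₁ → w ≢ b₂ → χ b₁ w ≡ β
      b₁-colours {w} w≢b₁ w≢b₂ with w ≟ v
      ... | yes refl = trans (χ-sym b₁ w) χvb₁≡β
      ... | no w≢v = trans (χ-sym b₁ w) (towards-exception w≢v w≢b₁ w≢b₂ (≢-sym v≢b₁) (≢-sym v≢b₂) b₁≢b₂ χvb₁≡β χvb₂≡β elsewhere)

    module TwoLargeClasses {v α β} (α≢β : α ≢ β)
      {a₁ a₂ a₃} (A-distinct : Unique (a₁ ∷ a₂ ∷ a₃ ∷ [])) (A : All (λ a → a ≢ v × χ v a ≡ α) (a₁ ∷ a₂ ∷ a₃ ∷ []))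
      {b₁ b₂ b₃} (B-distinct : Unique (b₁ ∷ b₂ ∷ b₃ ∷ [])) (B : All (λ b → b ≢ v × χ v b ≡ β) (b₁ ∷ b₂ ∷ b₃ ∷ [])) where

      h : Fin N → ℤ₃
      h = χ v
      D κ : ℤ₃
      D = deg χ v
      κ = ⊖ (α ⊕ β) ⊖ D

      affine : ∀ {u a} → u ≢ v → a ≢ v → u ≢ a → χ u a ≡ h u ⊕ h a ⊕ κ
      affine {u} {a} u≢v a≢v u≢a
        with one-of-three-avoiding A-distinct A u a | one-of-three-avoiding B-distinct B u a
      ... | z₁ , (z₁≢v , hz₁) , z₁≢u , z₁≢a | z₂ , (z₂≢v , hz₂) , z₂≢u , z₂≢a = solve (χ u a) D (h u) (h a) α β (begin
        ρ v u a              ≡⟨ ρ-forced (distinct₄ z₁≢u z₁≢a z₁≢v u≢a u≢v a≢v) (distinct₄ z₂≢u z₂≢a z₂≢v u≢a u≢v a≢v)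
                                         (λ hz₁≡hz₂ → α≢β (trans (sym hz₁) (trans hz₁≡hz₂ hz₂))) ⟩
        ⊖ (h z₁ ⊕ h z₂)      ≡⟨ cong₂ (λ p q → ⊖ (p ⊕ q)) hz₁ hz₂ ⟩
        ⊖ (α ⊕ β)            ∎)
        where
        open ≡-Reasoning
        solve : ∀ p D hu ha α β → p ⊕ D ⊖ hu ⊖ ha ≡ ⊖ (α ⊕ β) → p ≡ hu ⊕ ha ⊕ (⊖ (α ⊕ β) ⊖ D)
        solve = from-yes (all? λ p → all? λ D → all? λ hu → all? λ ha → all? λ α → all? λ β →
          p ⊕ D ⊖ hu ⊖ ha ≟ ⊖ (α ⊕ β) →-dec p ≟ hu ⊕ ha ⊕ (⊖ (α ⊕ β) ⊖ D))
      deg-other : ∀ {v′} → v′ ≢ v → deg χ v′ ≡ h v′ ⊕ κ ⊕ D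
      deg-other {v′} v′≢v with complement {xs = v′ ∷ v ∷ []} ((v′≢v ∷ []) ∷ [] ∷ [])
      ... | R , all↭ = begin
        deg χ v′                                          ≡⟨ deg-↭ χ all↭ ⟩
        χ v′ v ⊕ ∑ R (χ v′)                               ≡⟨ cong₂ _⊕_ (χ-sym v′ v) (∑-cong R (λ y∈R →
                                                              trans (affine v′≢v (≢v y∈R) (≢-sym (≢v′ y∈R))) (swap-last (h v′) _ κ))) ⟩
        h v′ ⊕ ∑[ y ∈ R ] (h v′ ⊕ κ ⊕ h y)                ≡⟨ cong (h v′ ⊕_) (∑-⊕ R (λ _ → h v′ ⊕ κ) h) ⟩
        h v′ ⊕ (∑[ y ∈ R ] (h v′ ⊕ κ) ⊕ ∑ R h)            ≡⟨ cong (λ s → h v′ ⊕ (s ⊕ ∑ R h)) (∑-const R (h v′ ⊕ κ)) ⟩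
        h v′ ⊕ ([ length R ]₃ ⊗ (h v′ ⊕ κ) ⊕ ∑ R h)       ≡⟨ cong₂ (λ n s → h v′ ⊕ (n ⊗ (h v′ ⊕ κ) ⊕ s)) |R| ∑Rh ⟩
        h v′ ⊕ ((0F ⊖ [ 2 ]₃) ⊗ (h v′ ⊕ κ) ⊕ (D ⊖ h v′))   ≡⟨ from-yes (all? λ p → all? λ k → all? λ D →
                                                                p ⊕ ((0F ⊖ [ 2 ]₃) ⊗ (p ⊕ k) ⊕ (D ⊖ p)) ≟ p ⊕ k ⊕ D) (h v′) κ D ⟩
        h v′ ⊕ κ ⊕ D                                      ∎
        where
        open ≡-Reasoning
        ≢v : ∀ {y} → y ∈ R → y ≢ v
        ≢v = complement-≢ (v′ ∷ v ∷ []) all↭ (there (here refl))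
        ≢v′ : ∀ {y} → y ∈ R → y ≢ v′
        ≢v′ = complement-≢ (v′ ∷ v ∷ []) all↭ (here refl)
        swap-last : ∀ a b c → a ⊕ b ⊕ c ≡ a ⊕ c ⊕ b
        swap-last = from-yes (all? λ a → all? λ b → all? λ c → a ⊕ b ⊕ c ≟ a ⊕ c ⊕ b)
        |R| : [ length R ]₃ ≡ 0F ⊖ [ 2 ]₃
        |R| = trans ([length-complement]₃ {xs = v′ ∷ v ∷ []} {zs = R} all↭) (cong (_⊖ [ 2 ]₃) [N]₃≡0)
        ∑Rh : ∑ R h ≡ D ⊖ h v′
        ∑Rh = trans (from-yes (all? λ a → all? λ s → s ≟ a ⊕ s ⊖ a) (h v′) (∑ R h))
                    (cong (_⊖ h v′) (sym (deg-↭ χ (↭-trans all↭ (↭-swap v′ v ↭-refl)))))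
      closing : ∀ {v′ z} → v′ ≢ v → z ≢ v → v′ ≢ z → h z ⊖ h v′ ≡ D ⊖ κ → ⊥
      closing {v′} {z} v′≢v z≢v v′≢z difference with fresh′ (v ∷ v′ ∷ z ∷ [])
      ... | u , u≢v ∷ u≢v′ ∷ u≢z ∷ [] with fresh′ (v ∷ v′ ∷ z ∷ u ∷ [])
      ... | a , a≢v ∷ a≢v′ ∷ a≢z ∷ a≢u ∷ [] =
        forbidden (distinct₄ (≢-sym u≢z) (≢-sym a≢z) (≢-sym v′≢z) (≢-sym a≢u) u≢v′ a≢v′) (begin
          χ v′ z                                   ≡⟨ affine v′≢v z≢v v′≢z ⟩
          h v′ ⊕ h z ⊕ κ                           ≡⟨ balance (h u) (h a) (h v′) (h z) κ D difference ⟩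
          (h u ⊕ h a ⊕ κ) ⊕ (h v′ ⊕ κ ⊕ D) ⊖ (h v′ ⊕ h u ⊕ κ) ⊖ (h v′ ⊕ h a ⊕ κ)
                                                   ≡⟨ cong₂ (λ p q → p ⊕ q ⊖ (h v′ ⊕ h u ⊕ κ) ⊖ (h v′ ⊕ h a ⊕ κ))
                                                        (affine u≢v a≢v (≢-sym a≢u)) (deg-other v′≢v) ⟨
          χ u a ⊕ deg χ v′ ⊖ (h v′ ⊕ h u ⊕ κ) ⊖ (h v′ ⊕ h a ⊕ κ)
                                                   ≡⟨ cong₂ (λ p q → χ u a ⊕ deg χ v′ ⊖ p ⊖ q)
                                                        (affine v′≢v u≢v (≢-sym u≢v′)) (affine v′≢v a≢v (≢-sym a≢v′)) ⟨
          ρ v′ u a                                 ∎)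
        where
        open ≡-Reasoning
        balance : ∀ hu ha hv hz k D → hz ⊖ hv ≡ D ⊖ k → hv ⊕ hz ⊕ k ≡ (hu ⊕ ha ⊕ k) ⊕ (hv ⊕ k ⊕ D) ⊖ (hv ⊕ hu ⊕ k) ⊖ (hv ⊕ ha ⊕ k)
        balance = from-yes (all? λ hu → all? λ ha → all? λ hv → all? λ hz → all? λ k → all? λ D →
          hz ⊖ hv ≟ D ⊖ k →-dec hv ⊕ hz ⊕ k ≟ (hu ⊕ ha ⊕ k) ⊕ (hv ⊕ k ⊕ D) ⊖ (hv ⊕ hu ⊕ k) ⊖ (hv ⊕ ha ⊕ k))
      impossible : ⊥
      impossible = from-members A B A-distinct
        where
        from-members : All (λ a → a ≢ v × h a ≡ α) (a₁ ∷ a₂ ∷ a₃ ∷ []) → All (λ b → b ≢ v × h b ≡ β) (b₁ ∷ b₂ ∷ b₃ ∷ []) →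
                       Unique (a₁ ∷ a₂ ∷ a₃ ∷ []) → ⊥
        from-members ((a₁≢v , χva₁) ∷ (a₂≢v , χva₂) ∷ _) ((b₁≢v , χvb₁) ∷ _) ((a₁≢a₂ ∷ _) ∷ _) =
          case difference-cases (D ⊖ κ) α≢β of λ
            { (inj₁ τ≡α⊖α) → closing a₁≢v a₂≢v a₁≢a₂ (trans (cong₂ _⊖_ χva₂ χva₁) (sym τ≡α⊖α))
            ; (inj₂ (inj₁ τ≡α⊖β)) → closing b₁≢v a₁≢v (≢-sym a₁≢b₁) (trans (cong₂ _⊖_ χva₁ χvb₁) (sym τ≡α⊖β))
            ; (inj₂ (inj₂ τ≡β⊖α)) → closing a₁≢v b₁≢v a₁≢b₁ (trans (cong₂ _⊖_ χvb₁ χva₁) (sym τ≡β⊖α))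
            }
          where
          a₁≢b₁ : a₁ ≢ b₁
          a₁≢b₁ a₁≡b₁ = α≢β (trans (sym χva₁) (trans (cong h a₁≡b₁) χvb₁))

    large-class : ∀ {v x y} → x ≢ v → y ≢ v → χ v x ≢ χ v y →
                  ∃₂ λ y₂ y₃ → Unique (y ∷ y₂ ∷ y₃ ∷ []) × All (λ b → b ≢ v × χ v b ≡ χ v y) (y ∷ y₂ ∷ y₃ ∷ [])
    large-class {v} {x} {y} x≢v y≢v α≢β with any? (λ w → (¬? (w ≟ v) ×-dec ¬? (w ≟ y)) ×-dec (χ v w ≟ χ v y))
    ... | no none = ⊥-elim (single-exception {v} {y} {χ v x} {χ v y} y≢v α≢β refl λ {w} w≢v w≢y →
                      two-colours x≢v y≢v w≢v α≢β (λ χvw≡β → none (w , (w≢v , w≢y) , χvw≡β)))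
    ... | yes (y₂ , (y₂≢v , y₂≢y) , χvy₂≡β)
      with any? (λ w → ((¬? (w ≟ v) ×-dec ¬? (w ≟ y)) ×-dec ¬? (w ≟ y₂)) ×-dec (χ v w ≟ χ v y))
    ...   | no none = ⊥-elim (two-exceptions {v} {y} {y₂} {χ v x} {χ v y} ((≢-sym y≢v ∷ ≢-sym y₂≢v ∷ []) ∷ (≢-sym y₂≢y ∷ []) ∷ [] ∷ []) α≢β refl χvy₂≡β
                        λ {w} w≢v w≢y w≢y₂ → two-colours x≢v y≢v w≢v α≢β (λ χvw≡β → none (w , ((w≢v , w≢y) , w≢y₂) , χvw≡β)))
    ...   | yes (y₃ , ((y₃≢v , y₃≢y) , y₃≢y₂) , χvy₃≡β) =
      y₂ , y₃ , ((≢-sym y₂≢y ∷ ≢-sym y₃≢y ∷ []) ∷ (≢-sym y₃≢y₂ ∷ []) ∷ [] ∷ []) ,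
      (y≢v , refl) ∷ (y₂≢v , χvy₂≡β) ∷ (y₃≢v , χvy₃≡β) ∷ []

    impossible : ⊥
    impossible with fresh′ []
    ... | v , [] with any? (λ x → any? λ y → (¬? (x ≟ v) ×-dec ¬? (y ≟ v)) ×-dec ¬? (χ v x ≟ χ v y))
    ... | yes (x , y , (x≢v , y≢v) , α≢β) with large-class {v} {x} {y} x≢v y≢v α≢β | large-class {v} {y} {x} y≢v x≢v (≢-sym α≢β)
    ...   | y₂ , y₃ , B-distinct , B | x₂ , x₃ , A-distinct , A =
      TwoLargeClasses.impossible {v} {χ v x} {χ v y} α≢β {x} {x₂} {x₃} A-distinct A {y} {y₂} {y₃} B-distinct B
    impossible | v , [] | no constant with fresh′ (v ∷ [])
    ... | w₀ , w₀≢v ∷ [] = monochromatic-vertex {v} {χ v w₀} λ {w} w≢v →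
      decidable-stable (χ v w ≟ χ v w₀) (λ χvw≢χvw₀ → constant (w , w₀ , (w≢v , w₀≢v) , χvw≢χvw₀))

  open UniqueDec (_≟_ {N}) using (unique?)

  zero-sum-S₁ : ∀ {m} → 4 + m ≡ N → ZeroSumStars χ 1 m
  zero-sum-S₁ 4+m≡N =
    case any? (λ v → any? λ u → any? λ a → any? λ z → unique? (z ∷ u ∷ a ∷ v ∷ []) ×-dec (χ v z ≟ ρ v u a)) of λ
      { (yes (v , u , a , z , distinct , hit)) → zero-sum-stars {v} {u} {a} {z} distinct hit 4+m≡N
      ; (no none) → ⊥-elim (NoZeroSumCopy.impossible (λ {v} {u} {a} {z} distinct hit → none (v , u , a , z , distinct , hit)))
      }

-- N ≡ 2 (mod 3): a zero-sum S(3, N − 5)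

indicator : ℤ₃ → ℤ₃ → ℤ₃
indicator κ c = if does (c ≟ κ) then 1F else 0F

indicator-≢ : ∀ {κ c} → c ≢ κ → indicator κ c ≡ 0F
indicator-≢ {κ} {c} = from-yes (all? λ κ → all? λ c → ¬? (c ≟ κ) →-dec indicator κ c ≟ 0F) κ c

mixture : ∀ {κ c p q r : ℤ₃} → (c ≡ κ → r ≡ p) → (c ≢ κ → r ≡ q) → r ≡ indicator κ c ⊗ p ⊕ (1F ⊖ indicator κ c) ⊗ q
mixture {κ} {c} {p} {q} {r} = from-yes (all? λ κ → all? λ c → all? λ p → all? λ q → all? λ r →
  (c ≟ κ →-dec r ≟ p) →-dec (¬? (c ≟ κ) →-dec r ≟ q) →-dec r ≟ indicator κ c ⊗ p ⊕ (1F ⊖ indicator κ c) ⊗ q) κ c p q r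

module ZeroSumS₃ {N : ℕ} (χ : Coloring N) (χ-sym : Symmetric χ) ([N]₃≡2 : [ N ]₃ ≡ 2F) (8≤N : 8 ≤ N) where

  fresh′ : ∀ (xs : List (Fin N)) {_ : True (length xs ℕ.<? 8)} → ∃ λ y → All (y ≢_) xs
  fresh′ = fresh-below 8≤N

  δ : Fin N → Fin N → Fin N → ℤ₃
  δ u v y = χ u y ⊖ χ v y

  -- The sum of the star u–S together with the star at v on all vertices outside u ∷ v ∷ S.
  weight : Fin N → Fin N → List (Fin N) → ℤ₃
  weight u v S = ∑ S (χ u) ⊕ (deg χ v ⊖ χ v u ⊖ ∑ S (χ v) ⊖ 0F)

  weight-via-δ : ∀ u v S → ∑ S (δ u v) ≡ χ v u ⊖ deg χ v → weight u v S ≡ 0F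
  weight-via-δ u v S ∑δ = begin
    ∑ S (χ u) ⊕ (deg χ v ⊖ χ v u ⊖ ∑ S (χ v) ⊖ 0F)                       ≡⟨ cong (λ s → s ⊕ (deg χ v ⊖ χ v u ⊖ ∑ S (χ v) ⊖ 0F)) ∑χu ⟩
    ∑ S (δ u v) ⊕ ∑ S (χ v) ⊕ (deg χ v ⊖ χ v u ⊖ ∑ S (χ v) ⊖ 0F)         ≡⟨ cong (λ s → s ⊕ ∑ S (χ v) ⊕ (deg χ v ⊖ χ v u ⊖ ∑ S (χ v) ⊖ 0F)) ∑δ ⟩
    χ v u ⊖ deg χ v ⊕ ∑ S (χ v) ⊕ (deg χ v ⊖ χ v u ⊖ ∑ S (χ v) ⊖ 0F)     ≡⟨ from-yes (all? λ a → all? λ D → all? λ s →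
                                                                           a ⊖ D ⊕ s ⊕ (D ⊖ a ⊖ s ⊖ 0F) ≟ 0F) (χ v u) (deg χ v) (∑ S (χ v)) ⟩
    0F                                                                   ∎
    where
    open ≡-Reasoning
    ∑χu : ∑ S (χ u) ≡ ∑ S (δ u v) ⊕ ∑ S (χ v)
    ∑χu = trans (∑-cong S (λ {y} _ → from-yes (all? λ a → all? λ b → a ≟ a ⊖ b ⊕ b) (χ u y) (χ v y)))
                (∑-⊕ S (δ u v) (χ v))

  count : Fin N → List (Fin N) → ℤ₃ → ℤ₃
  count x R κ = ∑[ w ∈ R ] indicator κ (χ x w)

  |others| : ∀ {v R} → allFin N ↭ v ∷ R → [ length R ]₃ ≡ 1F
  |others| {v} {R} all↭ = trans ([length-complement]₃ {xs = v ∷ []} {zs = R} all↭) (cong (_⊖ [ 1 ]₃) [N]₃≡2)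

  deg-difference : ∀ {u v R} → allFin N ↭ u ∷ v ∷ R → deg χ u ⊖ deg χ v ≡ ∑ R (δ u v)
  deg-difference {u} {v} {R} all↭ = begin
    deg χ u ⊖ deg χ v                               ≡⟨ cong₂ _⊖_ (deg-↭ χ all↭) (deg-↭ χ (↭-trans all↭ (↭-swap u v ↭-refl))) ⟩
    χ u v ⊕ ∑ R (χ u) ⊖ (χ v u ⊕ ∑ R (χ v))         ≡⟨ cong (λ a → χ u v ⊕ ∑ R (χ u) ⊖ (a ⊕ ∑ R (χ v))) (χ-sym v u) ⟩
    χ u v ⊕ ∑ R (χ u) ⊖ (χ u v ⊕ ∑ R (χ v))         ≡⟨ from-yes (all? λ a → all? λ s → all? λ t → a ⊕ s ⊖ (a ⊕ t) ≟ s ⊖ t) (χ u v) _ _ ⟩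
    ∑ R (χ u) ⊖ ∑ R (χ v)                           ≡⟨ ∑-⊖ R (χ u) (χ v) ⟨
    ∑ R (δ u v)                                     ∎
    where open ≡-Reasoning

  module NoZeroSumCopy (colour≢deg : ∀ {u v} → u ≢ v → χ v u ≢ deg χ v)
                    (no-zero-sum-S₃ : ∀ {u v s₁ s₂ s₃} → Unique (u ∷ s₁ ∷ s₂ ∷ s₃ ∷ v ∷ []) → weight u v (s₁ ∷ s₂ ∷ s₃ ∷ []) ≢ 0F) where

    no-two-unequal-pairs : ∀ {u v a b c d} → Unique (u ∷ v ∷ a ∷ b ∷ c ∷ d ∷ []) →
                           δ u v a ≢ δ u v b → δ u v c ≢ δ u v d → ⊥
    no-two-unequal-pairs {u} {v} {a} {b} {c} {d} distinct δa≢δb δc≢δd with fresh′ (u ∷ v ∷ a ∷ b ∷ c ∷ d ∷ [])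
    ... | e , e∉ with three-of-five (δ u v) {χ v u ⊖ deg χ v} a b c d e
                        (two-unequal-pairs-reach-everything _ _ _ _ _ (χ v u ⊖ deg χ v) δa≢δb δc≢δd)
    ... | s₁ , s₂ , s₃ , R , five↭ , ∑δ = no-zero-sum-S₃ distinct′ (weight-via-δ u v (s₁ ∷ s₂ ∷ s₃ ∷ []) ∑δ)
      where
      distinct′ : Unique (u ∷ s₁ ∷ s₂ ∷ s₃ ∷ v ∷ [])
      distinct′ = Unique-++⁻ˡ (u ∷ s₁ ∷ s₂ ∷ s₃ ∷ v ∷ []) (Unique-resp-↭
        (↭-trans (↭-prep u (↭-prep v five↭)) (↭-prep u (↭-sym (shift v (s₁ ∷ s₂ ∷ s₃ ∷ []) R))))
        (Unique-resp-↭ (∷↭∷ʳ e (u ∷ v ∷ a ∷ b ∷ c ∷ d ∷ [])) (e∉ ∷ distinct)))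

    NearlyConstant : Fin N → Fin N → Set
    NearlyConstant u v = ∃₂ λ c e → e ≢ u × e ≢ v × (∀ {y} → y ≢ u → y ≢ v → y ≢ e → δ u v y ≡ c)

    all-equal-is-nearly-constant : ∀ {u v} → (∀ {a b} → a ≢ u → a ≢ v → b ≢ u → b ≢ v → δ u v a ≡ δ u v b) →
                                   NearlyConstant u v
    all-equal-is-nearly-constant {u} {v} same with fresh′ (u ∷ v ∷ [])
    ... | e , e≢u ∷ e≢v ∷ [] = δ u v e , e , e≢u , e≢v , λ y≢u y≢v _ → same y≢u y≢v e≢u e≢v

    equal-off-unequal-pair : ∀ {u v a b w} → Unique (u ∷ v ∷ a ∷ b ∷ []) → All (w ≢_) (u ∷ v ∷ a ∷ b ∷ []) →
      δ u v a ≢ δ u v b → ∀ {y} → y ≢ u → y ≢ v → y ≢ a → y ≢ b → δ u v y ≡ δ u v w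
    equal-off-unequal-pair {u} {v} {a} {b} {w} distinct (w≢u ∷ w≢v ∷ w≢a ∷ w≢b ∷ []) δa≢δb {y} y≢u y≢v y≢a y≢b =
      decidable-stable (δ u v y ≟ δ u v w) λ δy≢δw →
        no-two-unequal-pairs
          (Unique-snoc (Unique-snoc distinct (y≢u ∷ y≢v ∷ y≢a ∷ y≢b ∷ []))
                       (w≢u ∷ w≢v ∷ w≢a ∷ w≢b ∷ (λ w≡y → δy≢δw (cong (δ u v) (sym w≡y))) ∷ []))
          δa≢δb δy≢δw

    unequal-pair-is-nearly-constant : ∀ {u v a b} → Unique (u ∷ v ∷ a ∷ b ∷ []) → δ u v a ≢ δ u v b → NearlyConstant u v
    unequal-pair-is-nearly-constant {u} {v} {a} {b} distinct@((_ ∷ u≢a ∷ u≢b ∷ []) ∷ (v≢a ∷ v≢b ∷ []) ∷ _) δa≢δb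
      with fresh′ (u ∷ v ∷ a ∷ b ∷ [])
    ... | w₀ , w₀∉ = case δ u v a ≟ δ u v w₀ of λ
      { (yes δa≡c) → δ u v w₀ , b , ≢-sym u≢b , ≢-sym v≢b , λ {y} y≢u y≢v y≢b → case y ≟ a of λ
          { (yes refl) → δa≡c ; (no y≢a) → off-pair y≢u y≢v y≢a y≢b }
      ; (no δa≢c) → case δ u v b ≟ δ u v w₀ of λ
          { (yes δb≡c) → δ u v w₀ , a , ≢-sym u≢a , ≢-sym v≢a , λ {y} y≢u y≢v y≢a → case y ≟ b of λ
              { (yes refl) → δb≡c ; (no y≢b) → off-pair y≢u y≢v y≢a y≢b }
          ; (no δb≢c) → case fresh′ (u ∷ v ∷ a ∷ b ∷ w₀ ∷ []) of λ
              { (w₁ , w₁∉@(w₁≢u ∷ w₁≢v ∷ w₁≢a ∷ w₁≢b ∷ _ ∷ [])) → ⊥-elim (no-two-unequal-pairs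
                  (Unique-resp-↭ (↭-prep u (↭-prep v (↭-prep a (↭-swap b w₀ ↭-refl))))
                                 (Unique-snoc (Unique-snoc distinct w₀∉) w₁∉))
                  δa≢c (λ δb≡δw₁ → δb≢c (trans δb≡δw₁ (off-pair w₁≢u w₁≢v w₁≢a w₁≢b)))) }
          }
      }
      where
      off-pair : ∀ {y} → y ≢ u → y ≢ v → y ≢ a → y ≢ b → δ u v y ≡ δ u v w₀
      off-pair = equal-off-unequal-pair distinct w₀∉ δa≢δb

    near-constant : ∀ {u v} → u ≢ v → NearlyConstant u v
    near-constant {u} {v} u≢v =
      case any? (λ a → any? λ b → ((¬? (a ≟ u) ×-dec ¬? (a ≟ v)) ×-dec (¬? (b ≟ u) ×-dec ¬? (b ≟ v))) ×-dec
                                   ¬? (δ u v a ≟ δ u v b)) of λ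
        { (no none) → all-equal-is-nearly-constant λ {a} {b} a≢u a≢v b≢u b≢v →
            decidable-stable (δ u v a ≟ δ u v b) (λ δa≢δb → none (a , b , ((a≢u , a≢v) , (b≢u , b≢v)) , δa≢δb))
        ; (yes (a , b , ((a≢u , a≢v) , (b≢u , b≢v)) , δa≢δb)) → unequal-pair-is-nearly-constant
            (distinct₄ u≢v (≢-sym a≢u) (≢-sym b≢u) (≢-sym a≢v) (≢-sym b≢v) (λ a≡b → δa≢δb (cong (δ u v) a≡b))) δa≢δb
        }

    other-colour-count : ∀ {x R κ} → allFin N ↭ x ∷ R → κ ≢ deg χ x → count x R κ ≡ 2F
    other-colour-count {x} {R} {κ} all↭ κ≢D =
      trans (by-value κ) (solve (count x R 0F) (count x R 1F) (count x R 2F) (deg χ x) κ total colour-sum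
                                 (trans (sym (by-value (deg χ x))) absent) κ≢D)
      where
      open ≡-Reasoning
      i : ℤ₃ → Fin N → ℤ₃
      i κ w = indicator κ (χ x w)
      by-value : ∀ κ → count x R κ ≡ lookup (count x R 0F ∷ count x R 1F ∷ count x R 2F ∷ []) κ
      by-value 0F = refl
      by-value 1F = refl
      by-value 2F = refl
      solve : ∀ n₀ n₁ n₂ D κ → n₀ ⊕ n₁ ⊕ n₂ ≡ 1F → D ≡ n₁ ⊕ n₂ ⊕ n₂ → lookup (n₀ ∷ n₁ ∷ n₂ ∷ []) D ≡ 0F →
              κ ≢ D → lookup (n₀ ∷ n₁ ∷ n₂ ∷ []) κ ≡ 2F
      solve = from-yes (all? λ n₀ → all? λ n₁ → all? λ n₂ → all? λ D → all? λ κ →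
        n₀ ⊕ n₁ ⊕ n₂ ≟ 1F →-dec D ≟ n₁ ⊕ n₂ ⊕ n₂ →-dec lookup (n₀ ∷ n₁ ∷ n₂ ∷ []) D ≟ 0F →-dec
        ¬? (κ ≟ D) →-dec lookup (n₀ ∷ n₁ ∷ n₂ ∷ []) κ ≟ 2F)
      total : count x R 0F ⊕ count x R 1F ⊕ count x R 2F ≡ 1F
      total = begin
        count x R 0F ⊕ count x R 1F ⊕ count x R 2F       ≡⟨ cong (_⊕ count x R 2F) (∑-⊕ R (i 0F) (i 1F)) ⟨
        ∑[ w ∈ R ] (i 0F w ⊕ i 1F w) ⊕ count x R 2F      ≡⟨ ∑-⊕ R (λ w → i 0F w ⊕ i 1F w) (i 2F) ⟨
        ∑[ w ∈ R ] (i 0F w ⊕ i 1F w ⊕ i 2F w)            ≡⟨ ∑-cong R (λ {w} _ → from-yes (all? λ c →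
                                                               indicator 0F c ⊕ indicator 1F c ⊕ indicator 2F c ≟ 1F) (χ x w)) ⟩
        ∑[ w ∈ R ] 1F                                    ≡⟨ ∑-const R 1F ⟩
        [ length R ]₃ ⊗ 1F                               ≡⟨ cong (_⊗ 1F) ([length-complement]₃ {xs = x ∷ []} {zs = R} all↭) ⟩
        ([ N ]₃ ⊖ [ 1 ]₃) ⊗ 1F                           ≡⟨ cong (λ n → (n ⊖ [ 1 ]₃) ⊗ 1F) [N]₃≡2 ⟩
        (2F ⊖ [ 1 ]₃) ⊗ 1F                               ≡⟨⟩
        1F                                               ∎
      colour-sum : deg χ x ≡ count x R 1F ⊕ count x R 2F ⊕ count x R 2F
      colour-sum = begin
        deg χ x                                          ≡⟨ deg-↭ χ all↭ ⟩
        ∑ R (χ x)                                        ≡⟨ ∑-cong R (λ {w} _ → from-yes (all? λ c →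
                                                               c ≟ indicator 1F c ⊕ indicator 2F c ⊕ indicator 2F c) (χ x w)) ⟩
        ∑[ w ∈ R ] (i 1F w ⊕ i 2F w ⊕ i 2F w)            ≡⟨ ∑-⊕ R (λ w → i 1F w ⊕ i 2F w) (i 2F) ⟩
        ∑[ w ∈ R ] (i 1F w ⊕ i 2F w) ⊕ count x R 2F      ≡⟨ cong (_⊕ count x R 2F) (∑-⊕ R (i 1F) (i 2F)) ⟩
        count x R 1F ⊕ count x R 2F ⊕ count x R 2F       ∎
      absent : count x R (deg χ x) ≡ 0F
      absent = begin
        count x R (deg χ x)                              ≡⟨ ∑-cong R (λ w∈R → indicator-≢ (colour≢deg (≢x w∈R))) ⟩
        ∑[ w ∈ R ] 0F                                    ≡⟨ ∑-const R 0F ⟩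
        [ length R ]₃ ⊗ 0F                               ≡⟨ from-yes (all? λ n → n ⊗ 0F ≟ 0F) [ length R ]₃ ⟩
        0F                                               ∎
        where
        ≢x : ∀ {w} → w ∈ R → w ≢ x
        ≢x = ≢centre all↭

    -- Off v and e, u sees colour deg v ⊕ c exactly where v sees deg v, i.e. nowhere; if that colour is
    -- not deg u it must still occur ≡ 2 (mod 3) times at u, hence both at v and at e.
    dichotomy : ∀ {u v e c} → u ≢ v → e ≢ u → e ≢ v → (∀ {y} → y ≢ u → y ≢ v → y ≢ e → δ u v y ≡ c) →
                deg χ u ≡ deg χ v ⊕ c ⊎ χ u v ≡ deg χ v ⊕ c
    dichotomy {u} {v} {e} {c} u≢v e≢u e≢v off
      with complement {xs = u ∷ v ∷ e ∷ []} ((u≢v ∷ ≢-sym e≢u ∷ []) ∷ (≢-sym e≢v ∷ []) ∷ [] ∷ [])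
    ... | R , all↭ = case deg χ v ⊕ c ≟ deg χ u of λ
      { (yes same) → inj₁ (sym same)
      ; (no κ≢D) → inj₂ (first-of-two (χ u v) (χ u e) (deg χ v ⊕ c) (begin
          indicator κ (χ u v) ⊕ (indicator κ (χ u e) ⊕ 0F)      ≡⟨ cong (λ s → indicator κ (χ u v) ⊕ (indicator κ (χ u e) ⊕ s)) rest ⟨
          count u (v ∷ e ∷ R) κ                                 ≡⟨ other-colour-count all↭ κ≢D ⟩
          2F                                                    ∎))
      }
      where
      open ≡-Reasoning
      κ : ℤ₃
      κ = deg χ v ⊕ c
      first-of-two : ∀ a b κ → indicator κ a ⊕ (indicator κ b ⊕ 0F) ≡ 2F → a ≡ κ
      first-of-two = from-yes (all? λ a → all? λ b → all? λ κ →
        indicator κ a ⊕ (indicator κ b ⊕ 0F) ≟ 2F →-dec a ≟ κ)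
      shifted : ∀ {y} → y ∈ R → indicator κ (χ u y) ≡ 0F
      shifted {y} y∈R = indicator-≢ (λ χuy≡κ → colour≢deg y≢v (shift-back (χ u y) (χ v y) (deg χ v) c
                          (off y≢u y≢v y≢e) χuy≡κ))
        where
        y≢u : y ≢ u
        y≢u = complement-≢ (u ∷ v ∷ e ∷ []) all↭ (here refl) y∈R
        y≢v : y ≢ v
        y≢v = complement-≢ (u ∷ v ∷ e ∷ []) all↭ (there (here refl)) y∈R
        y≢e : y ≢ e
        y≢e = complement-≢ (u ∷ v ∷ e ∷ []) all↭ (there (there (here refl))) y∈R
        shift-back : ∀ a b D c → a ⊖ b ≡ c → a ≡ D ⊕ c → b ≡ D
        shift-back = from-yes (all? λ a → all? λ b → all? λ D → all? λ c →
          a ⊖ b ≟ c →-dec a ≟ D ⊕ c →-dec b ≟ D)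
      rest : count u R κ ≡ 0F
      rest = begin
        count u R κ                  ≡⟨ ∑-cong R shifted ⟩
        ∑[ y ∈ R ] 0F                ≡⟨ ∑-const R 0F ⟩
        [ length R ]₃ ⊗ 0F           ≡⟨ from-yes (all? λ n → n ⊗ 0F ≟ 0F) [ length R ]₃ ⟩
        0F                           ∎

    twins : ∀ {x y} → x ≢ y → deg χ x ≡ deg χ y → ∀ {w} → w ≢ x → w ≢ y → χ x w ≡ χ y w
    twins {x} {y} x≢y same-deg = from-near-constancy (near-constant x≢y)
      where
      from-near-constancy : NearlyConstant x y → ∀ {w} → w ≢ x → w ≢ y → χ x w ≡ χ y w
      from-near-constancy (c , e , e≢x , e≢y , off) {w} w≢x w≢y = difference-zero (χ x w) (χ y w) (case w ≟ e of λ
        { (yes refl) → δe≡0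
        ; (no w≢e) → trans (off w≢x w≢y w≢e) c≡0
        })
        where
        open ≡-Reasoning
        difference-zero : ∀ a b → a ⊖ b ≡ 0F → a ≡ b
        difference-zero = from-yes (all? λ a → all? λ b → a ⊖ b ≟ 0F →-dec a ≟ b)
        off′ : ∀ {z} → z ≢ y → z ≢ x → z ≢ e → δ y x z ≡ ⊖ c
        off′ {z} z≢y z≢x z≢e = trans (from-yes (all? λ a → all? λ b → b ⊖ a ≟ ⊖ (a ⊖ b)) (χ x z) (χ y z))
                                     (cong ⊖_ (off z≢x z≢y z≢e))
        c≡0 : c ≡ 0F
        c≡0 = [ (λ deg-x → no-shift (deg χ y) c (trans (sym same-deg) deg-x))
              , (λ χxy → [ (λ deg-y → no-negative-shift (deg χ x) c (trans same-deg deg-y))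
                         , (λ χyx → opposite-shifts (deg χ y) c (trans (sym χxy) (trans (χ-sym x y)
                                      (trans χyx (cong (_⊕ ⊖ c) same-deg)))))
                         ]′ (dichotomy (≢-sym x≢y) e≢y e≢x off′))
              ]′ (dichotomy x≢y e≢x e≢y off)
          where
          no-shift : ∀ d c → d ≡ d ⊕ c → c ≡ 0F
          no-shift = from-yes (all? λ d → all? λ c → d ≟ d ⊕ c →-dec c ≟ 0F)
          no-negative-shift : ∀ d c → d ≡ d ⊕ ⊖ c → c ≡ 0F
          no-negative-shift = from-yes (all? λ d → all? λ c → d ≟ d ⊕ ⊖ c →-dec c ≟ 0F)
          opposite-shifts : ∀ d c → d ⊕ c ≡ d ⊕ ⊖ c → c ≡ 0F
          opposite-shifts = from-yes (all? λ d → all? λ c → d ⊕ c ≟ d ⊕ ⊖ c →-dec c ≟ 0F)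
        δe≡0 : δ x y e ≡ 0F
        δe≡0 with complement {xs = x ∷ y ∷ e ∷ []} ((x≢y ∷ ≢-sym e≢x ∷ []) ∷ (≢-sym e≢y ∷ []) ∷ [] ∷ [])
        ... | R , all↭ = begin
          δ x y e                          ≡⟨ from-yes (all? λ a → a ≟ a ⊕ 0F) (δ x y e) ⟩
          δ x y e ⊕ 0F                     ≡⟨ cong (δ x y e ⊕_) rest ⟨
          ∑ (e ∷ R) (δ x y)                ≡⟨ deg-difference all↭ ⟨
          deg χ x ⊖ deg χ y                ≡⟨ cong (_⊖ deg χ y) same-deg ⟩
          deg χ y ⊖ deg χ y                ≡⟨ from-yes (all? λ a → a ⊖ a ≟ 0F) (deg χ y) ⟩
          0F                               ∎
          where
          rest : ∑ R (δ x y) ≡ 0F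
          rest = begin
            ∑ R (δ x y)                    ≡⟨ ∑-cong R (λ z∈R → trans (off (complement-≢ (x ∷ y ∷ e ∷ []) all↭ (here refl) z∈R)
                                                                           (complement-≢ (x ∷ y ∷ e ∷ []) all↭ (there (here refl)) z∈R)
                                                                           (complement-≢ (x ∷ y ∷ e ∷ []) all↭ (there (there (here refl))) z∈R))
                                                                      c≡0) ⟩
            ∑[ z ∈ R ] 0F                  ≡⟨ ∑-const R 0F ⟩
            [ length R ]₃ ⊗ 0F             ≡⟨ from-yes (all? λ n → n ⊗ 0F ≟ 0F) [ length R ]₃ ⟩
            0F                             ∎

    module ThreeOfADegree {x x′ x″} (x≢x′ : x ≢ x′) (x≢x″ : x ≢ x″) (x′≢x″ : x′ ≢ x″)
                          (deg-x′ : deg χ x′ ≡ deg χ x) (deg-x″ : deg χ x″ ≡ deg χ x) where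
      open ≡-Reasoning
      d κ g : ℤ₃
      d = deg χ x
      κ = χ x x′
      g = ⊖ (d ⊕ κ)
      ι : Fin N → ℤ₃
      ι y = indicator d (deg χ y)
      ι-total : ℤ₃
      ι-total = ∑ (allFin N) ι
      κ≢d : κ ≢ d
      κ≢d = colour≢deg (≢-sym x≢x′)
      same-class : ∀ {y} → y ≢ x → deg χ y ≡ d → χ x y ≡ κ
      same-class {y} y≢x deg-y = case y ≟ x′ of λ
        { (yes refl) → refl
        ; (no y≢x′) → trans (χ-sym x y) (trans (twins y≢x′ (trans deg-y (sym deg-x′)) (≢-sym y≢x) x≢x′) (χ-sym x′ x))
        }
      other-class : ∀ {w} → deg χ w ≢ d → deg χ w ≡ κ × χ x w ≡ g
      other-class {w} deg-w≢d = from-near-constancy (near-constant w≢x)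
        where
        w≢x : w ≢ x
        w≢x refl = deg-w≢d refl
        w≢x′ : w ≢ x′
        w≢x′ refl = deg-w≢d deg-x′
        w≢x″ : w ≢ x″
        w≢x″ refl = deg-w≢d deg-x″
        f : ℤ₃
        f = χ w x
        towards : ∀ {z} → z ≢ x → deg χ z ≡ d → w ≢ z → χ w z ≡ f
        towards {z} z≢x deg-z w≢z = trans (χ-sym w z) (trans (sym (twins (≢-sym z≢x) (sym deg-z) w≢x w≢z)) (χ-sym x w))
        f≢d : f ≢ d
        f≢d f≡d = colour≢deg w≢x (trans (χ-sym x w) f≡d)
        f≢D : f ≢ deg χ w
        f≢D = colour≢deg (≢-sym w≢x)
        from-near-constancy : NearlyConstant w x → deg χ w ≡ κ × χ x w ≡ g
        from-near-constancy (c , e , e≢w , e≢x , off) =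
          [ (λ deg-w → third-degree (deg χ w) d f κ deg-w≢d (trans deg-w (cong (d ⊕_) c≡f⊖κ)) f≢d f≢D
                       , trans (χ-sym x w) (third-colour (deg χ w) d f κ deg-w≢d (trans deg-w (cong (d ⊕_) c≡f⊖κ)) f≢d f≢D))
          , (λ χwx → ⊥-elim (κ≢d (no-gap f d κ (trans χwx (cong (d ⊕_) c≡f⊖κ)))))
          ]′ (dichotomy w≢x e≢w e≢x off)
          where
          c≡f⊖κ : c ≡ f ⊖ κ
          c≡f⊖κ = case x′ ≟ e of λ
            { (no x′≢e) → trans (sym (off (≢-sym w≢x′) (≢-sym x≢x′) x′≢e))
                                (cong (_⊖ κ) (towards (≢-sym x≢x′) deg-x′ w≢x′))
            ; (yes refl) → trans (sym (off (≢-sym w≢x″) (≢-sym x≢x″) (≢-sym x′≢x″)))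
                                 (cong₂ _⊖_ (towards (≢-sym x≢x″) deg-x″ w≢x″) (same-class (≢-sym x≢x″) deg-x″))
            }
          no-gap : ∀ f d κ → f ≡ d ⊕ (f ⊖ κ) → κ ≡ d
          no-gap = from-yes (all? λ f → all? λ d → all? λ κ → f ≟ d ⊕ (f ⊖ κ) →-dec κ ≟ d)
          third-degree : ∀ D d f κ → D ≢ d → D ≡ d ⊕ (f ⊖ κ) → f ≢ d → f ≢ D → D ≡ κ
          third-degree = from-yes (all? λ D → all? λ d → all? λ f → all? λ κ →
            ¬? (D ≟ d) →-dec D ≟ d ⊕ (f ⊖ κ) →-dec ¬? (f ≟ d) →-dec ¬? (f ≟ D) →-dec D ≟ κ)
          third-colour : ∀ D d f κ → D ≢ d → D ≡ d ⊕ (f ⊖ κ) → f ≢ d → f ≢ D → f ≡ ⊖ (d ⊕ κ)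
          third-colour = from-yes (all? λ D → all? λ d → all? λ f → all? λ κ →
            ¬? (D ≟ d) →-dec D ≟ d ⊕ (f ⊖ κ) →-dec ¬? (f ≟ d) →-dec ¬? (f ≟ D) →-dec f ≟ ⊖ (d ⊕ κ))
      colours-at-x : ∀ {y} → y ≢ x → χ x y ≡ ι y ⊗ κ ⊕ (1F ⊖ ι y) ⊗ g
      colours-at-x y≢x = mixture (same-class y≢x) (λ deg-y≢d → proj₂ (other-class deg-y≢d))
      ι-total≡0 : ι-total ≡ 0F
      ι-total≡0 with others x
      ... | R , all↭ = begin
        ι-total                                       ≡⟨ ∑-↭ ι all↭ ⟩
        ι x ⊕ ∑ R ι                                   ≡⟨ cong₂ _⊕_ (from-yes (all? λ d → indicator d d ≟ 1F) d) two-thirds ⟩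
        1F ⊕ 2F                                       ∎
        where
        two-thirds : ∑ R ι ≡ 2F
        two-thirds = only-solution d κ (∑ R ι) κ≢d (begin
          d                                             ≡⟨ deg-↭ χ all↭ ⟩
          ∑ R (χ x)                                     ≡⟨ ∑-cong R (λ y∈R → colours-at-x (≢centre all↭ y∈R)) ⟩
          ∑[ y ∈ R ] (ι y ⊗ κ ⊕ (1F ⊖ ι y) ⊗ g)         ≡⟨ ∑-affine R ι κ g ⟩
          ∑ R ι ⊗ κ ⊕ ([ length R ]₃ ⊖ ∑ R ι) ⊗ g       ≡⟨ cong (λ n → ∑ R ι ⊗ κ ⊕ (n ⊖ ∑ R ι) ⊗ g) (|others| all↭) ⟩
          ∑ R ι ⊗ κ ⊕ (1F ⊖ ∑ R ι) ⊗ g                  ∎)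
          where
          only-solution : ∀ d κ m → κ ≢ d → d ≡ m ⊗ κ ⊕ (1F ⊖ m) ⊗ ⊖ (d ⊕ κ) → m ≡ 2F
          only-solution = from-yes (all? λ d → all? λ κ → all? λ m →
            ¬? (κ ≟ d) →-dec d ≟ m ⊗ κ ⊕ (1F ⊖ m) ⊗ ⊖ (d ⊕ κ) →-dec m ≟ 2F)
      all-in-class : ∀ {R} → (∀ {y} → y ∈ R → deg χ y ≡ d) → ∑ R ι ≡ [ length R ]₃
      all-in-class {R} in-class = begin
        ∑ R ι                       ≡⟨ ∑-cong R (λ y∈R → trans (cong (indicator d) (in-class y∈R))
                                                             (from-yes (all? λ d → indicator d d ≟ 1F) d)) ⟩
        ∑[ y ∈ R ] 1F               ≡⟨ ∑-const R 1F ⟩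
        [ length R ]₃ ⊗ 1F          ≡⟨ from-yes (all? λ n → n ⊗ 1F ≟ n) [ length R ]₃ ⟩
        [ length R ]₃               ∎
      outsider : ∃ λ w → deg χ w ≢ d
      outsider = case any? (λ w → ¬? (deg χ w ≟ d)) of λ
        { (yes found) → found
        ; (no none) → ⊥-elim (contradiction (begin
            2F                      ≡⟨ [N]₃≡2 ⟨
            [ N ]₃                  ≡⟨ cong [_]₃ (List.length-tabulate {n = N} (λ i → i)) ⟨
            [ length (allFin N) ]₃  ≡⟨ all-in-class {allFin N} (λ {y} _ → decidable-stable (deg χ y ≟ d) (λ ≢d → none (y , ≢d))) ⟨
            ι-total                 ≡⟨ ι-total≡0 ⟩
            0F                      ∎) λ ())
        }
      no-outsider : ∀ {w R} → deg χ w ≢ d → allFin N ↭ w ∷ R → ⊥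
      no-outsider {w} {R} deg-w≢d all↭ = case any? (λ w′ → ¬? (w′ ≟ w) ×-dec ¬? (deg χ w′ ≟ d)) of λ
        { (no none) → contradiction (begin
            1F                       ≡⟨ |others| all↭ ⟨
            [ length R ]₃            ≡⟨ all-in-class (λ {y} y∈R → decidable-stable (deg χ y ≟ d)
                                          (λ ≢d → none (y , ≢centre all↭ y∈R , ≢d))) ⟨
            ∑ R ι                    ≡⟨ ∑R≡0 ⟩
            0F                       ∎) λ ()
        ; (yes (w′ , w′≢w , deg-w′≢d)) → colour≢deg w′≢w (begin
            χ w w′                                           ≡⟨ from-yes (all? λ g → all? λ ε → ε ≟ 0F ⊗ g ⊕ (1F ⊖ 0F) ⊗ ε) g (χ w w′) ⟩
            0F ⊗ g ⊕ (1F ⊖ 0F) ⊗ χ w w′                      ≡⟨ cong₂ (λ m n → m ⊗ g ⊕ (n ⊖ m) ⊗ χ w w′) ∑R≡0 (|others| all↭) ⟨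
            ∑ R ι ⊗ g ⊕ ([ length R ]₃ ⊖ ∑ R ι) ⊗ χ w w′     ≡⟨ ∑-affine R ι g (χ w w′) ⟨
            ∑[ y ∈ R ] (ι y ⊗ g ⊕ (1F ⊖ ι y) ⊗ χ w w′)       ≡⟨ ∑-cong R (λ y∈R → colours-at-w w′≢w deg-w′≢d (≢centre all↭ y∈R)) ⟨
            ∑ R (χ w)                                        ≡⟨ deg-↭ χ all↭ ⟨
            deg χ w                                          ∎)
        }
        where
        χxw≡g : χ x w ≡ g
        χxw≡g = proj₂ (other-class deg-w≢d)
        w≢x : w ≢ x
        w≢x refl = deg-w≢d refl
        ∑R≡0 : ∑ R ι ≡ 0F
        ∑R≡0 = begin
          ∑ R ι                    ≡⟨⟩
          0F ⊕ ∑ R ι               ≡⟨ cong (_⊕ ∑ R ι) (indicator-≢ deg-w≢d) ⟨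
          ι w ⊕ ∑ R ι              ≡⟨ ∑-↭ ι all↭ ⟨
          ι-total                  ≡⟨ ι-total≡0 ⟩
          0F                       ∎
        colours-at-w : ∀ {w′ y} → w′ ≢ w → deg χ w′ ≢ d → y ≢ w → χ w y ≡ ι y ⊗ g ⊕ (1F ⊖ ι y) ⊗ χ w w′
        colours-at-w {w′} {y} w′≢w deg-w′≢d y≢w = mixture
          (λ deg-y → case y ≟ x of λ
            { (yes refl) → trans (χ-sym w y) χxw≡g
            ; (no y≢x) → trans (χ-sym w y) (trans (twins y≢x deg-y (≢-sym y≢w) w≢x) χxw≡g) })
          (λ deg-y≢d → case y ≟ w′ of λ
            { (yes refl) → refl
            ; (no y≢w′) → trans (χ-sym w y) (trans (twins y≢w′ (trans (proj₁ (other-class deg-y≢d)) (sym (proj₁ (other-class deg-w′≢d))))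
                                                           (≢-sym y≢w) (≢-sym w′≢w))
                                                    (χ-sym w′ w)) })

      impossible : ⊥
      impossible = no-outsider (proj₂ outsider) (proj₂ (others (proj₁ outsider)))

    impossible : ⊥
    impossible = case three-alike (deg χ) (allFin N) (allFin⁺ N) |allFin|≥7 of λ
      { (x , x′ , x″ , (x≢x′ ∷ x≢x″ ∷ []) ∷ (x′≢x″ ∷ []) ∷ [] ∷ [] , deg-x′ , deg-x″) →
          ThreeOfADegree.impossible {x} {x′} {x″} x≢x′ x≢x″ x′≢x″ deg-x′ deg-x″ }
      where
      |allFin|≥7 : 7 ≤ length (allFin N)
      |allFin|≥7 = subst (7 ≤_) (sym (List.length-tabulate (λ i → i))) (ℕ.≤-trans (ℕ.n≤1+n 7) 8≤N)

  open UniqueDec (_≟_ {N}) using (unique?)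

  zero-sum-S₃ : ∀ {m} → 5 + m ≡ N → ZeroSumStars χ 3 m
  zero-sum-S₃ {m} 5+m≡N =
    case any? (λ u → any? λ v → ¬? (u ≟ v) ×-dec (χ v u ≟ deg χ v)) of λ
      { (yes (u , v , u≢v , χvu≡D)) →
          lift-stars χ 1 2≤m (stars-on-complement χ u v [] [] ((u≢v ∷ []) ∷ [] ∷ []) 5+m≡N
            (trans (cong (λ a → 0F ⊕ (deg χ v ⊖ a ⊖ 0F ⊖ 0F)) χvu≡D)
                   (from-yes (all? λ D → 0F ⊕ (D ⊖ D ⊖ 0F ⊖ 0F) ≟ 0F) (deg χ v))))
      ; (no colour≢deg) →
          case any? (λ u → any? λ v → any? λ s₁ → any? λ s₂ → any? λ s₃ →
                 unique? (u ∷ s₁ ∷ s₂ ∷ s₃ ∷ v ∷ []) ×-dec (weight u v (s₁ ∷ s₂ ∷ s₃ ∷ []) ≟ 0F)) of λ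
            { (yes (u , v , s₁ , s₂ , s₃ , distinct , balanced)) →
                stars-on-complement χ u v (s₁ ∷ s₂ ∷ s₃ ∷ []) [] distinct 5+m≡N balanced
            ; (no no-zero-sum-S₃) → ⊥-elim (NoZeroSumCopy.impossible
                (λ {u} {v} u≢v χvu≡D → colour≢deg (u , v , u≢v , χvu≡D))
                (λ {u} {v} {s₁} {s₂} {s₃} distinct balanced → no-zero-sum-S₃ (u , v , s₁ , s₂ , s₃ , distinct , balanced)))
            }
      }
    where
    2≤m : 2 ≤ m
    2≤m = ℕ.≤-trans (ℕ.n≤1+n 2) (ℕ.+-cancelˡ-≤ 5 3 m (subst (8 ≤_) (sym 5+m≡N) 8≤N))

-- Lower bounds

too-few-vertices : ∀ G {M} → M < V G → ¬ ZeroSumProp G M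
too-few-vertices G M<V zero-sum with zero-sum (λ _ _ → 0F) (λ _ _ → refl)
... | f , f-injective , _ = ℕ.<⇒≱ M<V (injective⇒≤ f-injective)

injective-hits-zero : ∀ {n} {f : Fin (suc n) → Fin (suc n)} → Injective _≡_ _≡_ f → ∃ λ j → f j ≡ zero
injective-hits-zero {n} {f} f-injective = decidable-stable (any? (λ j → f j ≟ zero)) λ none →
  let missed : ∀ j → zero ≢ f j
      missed j 0≡fj = none (j , sym 0≡fj)
  in ℕ.1+n≰n (injective⇒≤ {f = λ j → punchOut (missed j)} (λ e → f-injective (punchOut-injective (missed _) (missed _) e)))

-- Colour 1 on the edges at vertex 0 and 0 elsewhere: the sum of a copy is the degree in S of the
-- vertex mapped onto 0, which is d₁, d₂ or 1.
module StarColouring (d₁ d₂ : ℕ) where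

  marked : Fin (V (S d₁ d₂)) → ℤ₃
  marked zero    = 1F
  marked (suc _) = 0F

  χ₀ : Coloring (V (S d₁ d₂))
  χ₀ a b = marked a ⊕ marked b

  χ₀-symmetric : Symmetric χ₀
  χ₀-symmetric a b = ⊕-comm (marked a) (marked b)

  left≢right : ∀ a b → a ↑ˡ suc d₂ ≢ suc d₁ ↑ʳ b
  left≢right a b e with trans (sym (splitAt-↑ˡ (suc d₁) a (suc d₂))) (trans (cong (splitAt (suc d₁)) e) (splitAt-↑ʳ (suc d₁) (suc d₂) b))
  ... | ()

  joined : ∀ {y p} → splitAt (suc d₁) y ≡ p → y ≡ join (suc d₁) (suc d₂) p
  joined {y} e = trans (sym (join-splitAt (suc d₁) (suc d₂) y)) (cong (join (suc d₁) (suc d₂)) e)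

  vertex-kinds : ∀ y → y ≡ centreˡ d₁ d₂ ⊎ (∃ λ i → y ≡ leafˡ d₁ d₂ i) ⊎ y ≡ centreʳ d₁ d₂ ⊎ (∃ λ j → y ≡ leafʳ d₁ d₂ j)
  vertex-kinds y with splitAt (suc d₁) y in eq
  ... | inj₁ zero    = inj₁ (joined eq)
  ... | inj₁ (suc i) = inj₂ (inj₁ (i , joined eq))
  ... | inj₂ zero    = inj₂ (inj₂ (inj₁ (joined eq)))
  ... | inj₂ (suc j) = inj₂ (inj₂ (inj₂ (j , joined eq)))

  module _ {f : Fin (V (S d₁ d₂)) → Fin (V (S d₁ d₂))} (f-injective : Injective _≡_ _≡_ f) {j₀} (f-j₀ : f j₀ ≡ zero) where

    ψ : Fin (V (S d₁ d₂)) → ℤ₃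
    ψ y = marked (f y)

    ψ-j₀ : ψ j₀ ≡ 1F
    ψ-j₀ = cong marked f-j₀

    ψ-elsewhere : ∀ {y} → y ≢ j₀ → ψ y ≡ 0F
    ψ-elsewhere {y} y≢j₀ with f y in f-y
    ... | zero  = contradiction (f-injective (trans f-y (sym f-j₀))) y≢j₀
    ... | suc _ = refl

    missed : ∀ {n} (g : Fin n → Fin (V (S d₁ d₂))) → (∀ i → g i ≢ j₀) → ∑ (allFin n) (ψ ∘ g) ≡ 0F
    missed {n} g g≢j₀ = begin
      ∑ (allFin n) (ψ ∘ g)       ≡⟨ ∑-cong (allFin n) (λ {i} _ → ψ-elsewhere (g≢j₀ i)) ⟩
      ∑[ i ∈ allFin n ] 0F       ≡⟨ ∑-const (allFin n) 0F ⟩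
      [ length (allFin n) ]₃ ⊗ 0F ≡⟨ from-yes (all? λ a → a ⊗ 0F ≟ 0F) [ length (allFin n) ]₃ ⟩
      0F                         ∎
      where open ≡-Reasoning

    hit-once : ∀ {n} (g : Fin n → Fin (V (S d₁ d₂))) → Injective _≡_ _≡_ g → ∀ {i₀} → g i₀ ≡ j₀ → ∑ (allFin n) (ψ ∘ g) ≡ 1F
    hit-once {n} g g-injective {i₀} g-i₀ with complement {xs = i₀ ∷ []} ([] ∷ [])
    ... | R , all↭ = begin
      ∑ (allFin n) (ψ ∘ g)         ≡⟨ ∑-↭ (ψ ∘ g) all↭ ⟩
      ψ (g i₀) ⊕ ∑ R (ψ ∘ g)        ≡⟨ cong₂ _⊕_ (trans (cong ψ g-i₀) ψ-j₀) (∑-cong R (λ i∈R → ψ-elsewhere (λ g-i → i≢i₀ i∈R (g-injective (trans g-i (sym g-i₀)))))) ⟩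
      1F ⊕ ∑[ i ∈ R ] 0F            ≡⟨ cong (1F ⊕_) (∑-const R 0F) ⟩
      1F ⊕ [ length R ]₃ ⊗ 0F       ≡⟨ from-yes (all? λ a → 1F ⊕ a ⊗ 0F ≟ 1F) [ length R ]₃ ⟩
      1F                            ∎
      where
      open ≡-Reasoning
      i≢i₀ : ∀ {i} → i ∈ R → i ≢ i₀
      i≢i₀ = ≢centre all↭

    star-sum : ∀ {n} c (g : Fin n → Fin (V (S d₁ d₂))) → ∑[ i ∈ allFin n ] χ₀ (f c) (f (g i)) ≡ [ n ]₃ ⊗ ψ c ⊕ ∑ (allFin n) (ψ ∘ g)
    star-sum {n} c g = begin
      ∑[ i ∈ allFin n ] (ψ c ⊕ ψ (g i))               ≡⟨ ∑-⊕ (allFin n) (λ _ → ψ c) (ψ ∘ g) ⟩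
      ∑[ i ∈ allFin n ] ψ c ⊕ ∑ (allFin n) (ψ ∘ g)     ≡⟨ cong (_⊕ ∑ (allFin n) (ψ ∘ g)) (∑-const (allFin n) (ψ c)) ⟩
      [ length (allFin n) ]₃ ⊗ ψ c ⊕ ∑ (allFin n) (ψ ∘ g)
                                                      ≡⟨ cong (λ l → [ l ]₃ ⊗ ψ c ⊕ ∑ (allFin n) (ψ ∘ g)) (List.length-tabulate {n = n} (λ i → i)) ⟩
      [ n ]₃ ⊗ ψ c ⊕ ∑ (allFin n) (ψ ∘ g)              ∎
      where open ≡-Reasoning

    total : ℤ₃ → ℤ₃ → ℤ₃ → ℤ₃ → ℤ₃
    total p L q K = [ d₁ ]₃ ⊗ p ⊕ L ⊕ ([ d₂ ]₃ ⊗ q ⊕ K)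

    total-nonzero : [ d₁ ]₃ ≢ 0F → [ d₂ ]₃ ≢ 0F →
      total (ψ (centreˡ d₁ d₂)) (∑ (allFin d₁) (ψ ∘ leafˡ d₁ d₂)) (ψ (centreʳ d₁ d₂)) (∑ (allFin d₂) (ψ ∘ leafʳ d₁ d₂)) ≢ 0F
    total-nonzero r₁ r₂ = [ at-centreˡ , [ at-leafˡ , [ at-centreʳ , at-leafʳ ]′ ]′ ]′ (vertex-kinds j₀)
      where
      congᵀ : ∀ {p L q K p′ L′ q′ K′} → p ≡ p′ → L ≡ L′ → q ≡ q′ → K ≡ K′ → total p L q K ≡ total p′ L′ q′ K′
      congᵀ refl refl refl refl = refl
      centreˡ≢leafˡ : ∀ i → centreˡ d₁ d₂ ≢ leafˡ d₁ d₂ i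
      centreˡ≢leafˡ i e with ↑ˡ-injective (suc d₂) zero (suc i) e
      ... | ()
      centreʳ≢leafʳ : ∀ j → centreʳ d₁ d₂ ≢ leafʳ d₁ d₂ j
      centreʳ≢leafʳ j e with ↑ʳ-injective (suc d₁) zero (suc j) e
      ... | ()
      leafˡ-injective : Injective _≡_ _≡_ (leafˡ d₁ d₂)
      leafˡ-injective e = suc-injective (↑ˡ-injective (suc d₂) _ _ e)
      leafʳ-injective : Injective _≡_ _≡_ (leafʳ d₁ d₂)
      leafʳ-injective e = suc-injective (↑ʳ-injective (suc d₁) _ _ e)
      at : ∀ {y} → j₀ ≡ y → ψ y ≡ 1F
      at j₀≡y = trans (cong ψ (sym j₀≡y)) ψ-j₀
      away : ∀ {y z} → j₀ ≡ y → z ≢ y → ψ z ≡ 0F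
      away j₀≡y z≢y = ψ-elsewhere (λ z≡j₀ → z≢y (trans z≡j₀ j₀≡y))
      at-centreˡ : j₀ ≡ centreˡ d₁ d₂ → _
      at-centreˡ j₀≡ = r₁ ∘ trans (sym (from-yes (all? λ a → all? λ b → a ⊗ 1F ⊕ 0F ⊕ (b ⊗ 0F ⊕ 0F) ≟ a) [ d₁ ]₃ [ d₂ ]₃))
        ∘ trans (sym (congᵀ (at j₀≡) (missed _ (λ i → λ l≡j₀ → centreˡ≢leafˡ i (sym (trans l≡j₀ j₀≡))))
                           (away j₀≡ (λ e → left≢right zero zero (sym e))) (missed _ (λ j l≡j₀ → left≢right zero (suc j) (sym (trans l≡j₀ j₀≡))))))
      at-leafˡ : (∃ λ i → j₀ ≡ leafˡ d₁ d₂ i) → _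
      at-leafˡ (i₀ , j₀≡) = (λ ()) ∘ trans (sym (from-yes (all? λ a → all? λ b → a ⊗ 0F ⊕ 1F ⊕ (b ⊗ 0F ⊕ 0F) ≟ 1F) [ d₁ ]₃ [ d₂ ]₃))
        ∘ trans (sym (congᵀ (away j₀≡ (centreˡ≢leafˡ i₀)) (hit-once _ leafˡ-injective (sym j₀≡))
                           (away j₀≡ (λ e → left≢right (suc i₀) zero (sym e))) (missed _ (λ j l≡j₀ → left≢right (suc i₀) (suc j) (sym (trans l≡j₀ j₀≡))))))
      at-centreʳ : j₀ ≡ centreʳ d₁ d₂ → _
      at-centreʳ j₀≡ = r₂ ∘ trans (sym (from-yes (all? λ a → all? λ b → a ⊗ 0F ⊕ 0F ⊕ (b ⊗ 1F ⊕ 0F) ≟ b) [ d₁ ]₃ [ d₂ ]₃))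
        ∘ trans (sym (congᵀ (away j₀≡ (left≢right zero zero)) (missed _ (λ i l≡j₀ → left≢right (suc i) zero (trans l≡j₀ j₀≡)))
                           (at j₀≡) (missed _ (λ j l≡j₀ → centreʳ≢leafʳ j (sym (trans l≡j₀ j₀≡))))))
      at-leafʳ : (∃ λ j → j₀ ≡ leafʳ d₁ d₂ j) → _
      at-leafʳ (j₀′ , j₀≡) = (λ ()) ∘ trans (sym (from-yes (all? λ a → all? λ b → a ⊗ 0F ⊕ 0F ⊕ (b ⊗ 0F ⊕ 1F) ≟ 1F) [ d₁ ]₃ [ d₂ ]₃))
        ∘ trans (sym (congᵀ (away j₀≡ (left≢right zero (suc j₀′))) (missed _ (λ i l≡j₀ → left≢right (suc i) (suc j₀′) (trans l≡j₀ j₀≡)))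
                           (away j₀≡ (centreʳ≢leafʳ j₀′)) (hit-once _ leafʳ-injective (sym j₀≡))))

  no-zero-sum-copy : [ d₁ ]₃ ≢ 0F → [ d₂ ]₃ ≢ 0F → ¬ ZeroSumProp (S d₁ d₂) (V (S d₁ d₂))
  no-zero-sum-copy r₁ r₂ zero-sum =
    let (f , f-injective , balanced) = zero-sum χ₀ χ₀-symmetric
        (j₀ , f-j₀) = injective-hits-zero f-injective
    in total-nonzero f-injective f-j₀ r₁ r₂ (toℕ-injective
         (trans (cong toℕ (sym (cong₂ _⊕_ (star-sum f-injective f-j₀ (centreˡ d₁ d₂) (leafˡ d₁ d₂))
                                             (star-sum f-injective f-j₀ (centreʳ d₁ d₂) (leafʳ d₁ d₂)))))
                (trans (sym (copySum-S χ₀ f)) balanced)))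

lower-bound : ∀ {d₁ d₂ M} → M < d₁ + d₂ + 2 → ¬ ZeroSumProp (S d₁ d₂) M
lower-bound {d₁} {d₂} {M} M< = too-few-vertices (S d₁ d₂) (subst (M <_) (|V| d₁ d₂) M<)
  where
  open +-*-Solver
  |V| : ∀ a b → a + b + 2 ≡ suc a + suc b
  |V| = solve 2 (λ a b → a :+ b :+ con 2 := con 1 :+ a :+ (con 1 :+ b)) refl

lower-bound-1-2 : ∀ {d₁ d₂ M} → [ d₁ ]₃ ≢ 0F → [ d₂ ]₃ ≢ 0F → M < d₁ + d₂ + 3 → ¬ ZeroSumProp (S d₁ d₂) M
lower-bound-1-2 {d₁} {d₂} {M} r₁ r₂ M< with ℕ.m≤n⇒m<n∨m≡n (ℕ.≤-pred (subst (M <_) (|V|+1 d₁ d₂) M<))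
  where
  open +-*-Solver
  |V|+1 : ∀ a b → a + b + 3 ≡ suc (suc a + suc b)
  |V|+1 = solve 2 (λ a b → a :+ b :+ con 3 := con 1 :+ (con 1 :+ a :+ (con 1 :+ b))) refl
... | inj₁ M<V = too-few-vertices (S d₁ d₂) M<V
... | inj₂ refl = StarColouring.no-zero-sum-copy d₁ d₂ r₁ r₂

-- Upper bounds

[n]₃-from-% : ∀ {n} {r : ℤ₃} → n % 3 ≡ toℕ r → [ n ]₃ ≡ r
[n]₃-from-% {n} n%3≡r = toℕ-injective (trans (toℕ-[n]₃ n) n%3≡r)

quotient-by-three : ∀ {n r} → n % 3 ≡ r → n ≡ r + (n / 3) * 3
quotient-by-three {n} n%3≡r = trans (m≡m%n+[m/n]*n n 3) (cong (_+ (n / 3) * 3) n%3≡r)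

positive-multiple-of-three : ∀ {n} → 1 ≤ n → n % 3 ≡ 0 → ∃ λ j → n ≡ 3 + j * 3
positive-multiple-of-three {n} 1≤n n%3≡0 = from-quotient (n / 3) (quotient-by-three n%3≡0)
  where
  from-quotient : ∀ q → n ≡ 0 + q * 3 → ∃ λ j → n ≡ 3 + j * 3
  from-quotient zero    n≡0 = contradiction (subst (1 ≤_) n≡0 1≤n) λ ()
  from-quotient (suc j) n≡  = j , n≡

module _ {N : ℕ} (χ : Coloring N) (χ-sym : Symmetric χ) where
  open +-*-Solver

  zero-sum-stars-1-2 : ∀ {a b} → a % 3 ≡ 1 → b % 3 ≡ 2 → a + b + 3 ≡ N → ZeroSumStars χ a b
  zero-sum-stars-1-2 {a} {b} a%3≡1 b%3≡2 a+b+3≡N = subst (λ a → ZeroSumStars χ a b) (sym a≡1+k*3)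
    (lift-stars χ k 2≤b (ZeroSumS₁.zero-sum-S₁ χ χ-sym [N]₃≡0 6≤N 4+m≡N))
    where
    k : ℕ
    k = a / 3
    a≡1+k*3 : a ≡ 1 + k * 3
    a≡1+k*3 = quotient-by-three a%3≡1
    2≤b : 2 ≤ b
    2≤b = subst (_≤ b) b%3≡2 (m%n≤m b 3)
    N≡ : N ≡ (1 + k * 3) + b + 3
    N≡ = trans (sym a+b+3≡N) (cong (λ a → a + b + 3) a≡1+k*3)
    4+m≡N : 4 + (k * 3 + b) ≡ N
    4+m≡N = trans (solve 2 (λ x y → con 4 :+ (x :+ y) := con 1 :+ x :+ y :+ con 3) refl (k * 3) b) (sym N≡)
    [N]₃≡0 : [ N ]₃ ≡ 0F
    [N]₃≡0 = begin
      [ N ]₃                       ≡⟨ cong [_]₃ a+b+3≡N ⟨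
      [ a + b + 3 ]₃               ≡⟨ [m+n]₃≡[m]₃⊕[n]₃ (a + b) 3 ⟩
      [ a + b ]₃ ⊕ [ 3 ]₃          ≡⟨ cong (_⊕ [ 3 ]₃) ([m+n]₃≡[m]₃⊕[n]₃ a b) ⟩
      [ a ]₃ ⊕ [ b ]₃ ⊕ [ 3 ]₃     ≡⟨ cong₂ (λ p q → p ⊕ q ⊕ [ 3 ]₃) ([n]₃-from-% {a} a%3≡1) ([n]₃-from-% {b} b%3≡2) ⟩
      0F                           ∎
      where open ≡-Reasoning
    6≤N : 6 ≤ N
    6≤N = subst (6 ≤_) (sym N≡) (ℕ.+-monoˡ-≤ 3 (ℕ.+-mono-≤ (s≤s z≤n) 2≤b))

  zero-sum-stars-0-0 : ∀ {a b} → 1 ≤ a → 1 ≤ b → a % 3 ≡ 0 → b % 3 ≡ 0 → a + b + 2 ≡ N → ZeroSumStars χ a b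
  zero-sum-stars-0-0 {a} {b} 1≤a 1≤b a%3≡0 b%3≡0 a+b+2≡N
    with positive-multiple-of-three 1≤a a%3≡0 | positive-multiple-of-three 1≤b b%3≡0
  ... | j , a≡3+j*3 | j′ , b≡3+j′*3 = subst (λ a → ZeroSumStars χ a b) (sym a≡3+j*3)
    (lift-stars χ j 2≤b (ZeroSumS₃.zero-sum-S₃ χ χ-sym [N]₃≡2 8≤N 5+m≡N))
    where
    2≤b : 2 ≤ b
    2≤b = subst (2 ≤_) (sym b≡3+j′*3) (s≤s (s≤s z≤n))
    N≡ : N ≡ (3 + j * 3) + b + 2
    N≡ = trans (sym a+b+2≡N) (cong (λ a → a + b + 2) a≡3+j*3)
    5+m≡N : 5 + (j * 3 + b) ≡ N
    5+m≡N = trans (solve 2 (λ x y → con 5 :+ (x :+ y) := con 3 :+ x :+ y :+ con 2) refl (j * 3) b) (sym N≡)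
    [N]₃≡2 : [ N ]₃ ≡ 2F
    [N]₃≡2 = begin
      [ N ]₃                       ≡⟨ cong [_]₃ a+b+2≡N ⟨
      [ a + b + 2 ]₃               ≡⟨ [m+n]₃≡[m]₃⊕[n]₃ (a + b) 2 ⟩
      [ a + b ]₃ ⊕ [ 2 ]₃          ≡⟨ cong (_⊕ [ 2 ]₃) ([m+n]₃≡[m]₃⊕[n]₃ a b) ⟩
      [ a ]₃ ⊕ [ b ]₃ ⊕ [ 2 ]₃     ≡⟨ cong₂ (λ p q → p ⊕ q ⊕ [ 2 ]₃) ([n]₃-from-% {a} a%3≡0) ([n]₃-from-% {b} b%3≡0) ⟩
      2F                           ∎
      where open ≡-Reasoning
    8≤N : 8 ≤ N
    8≤N = subst (8 ≤_) (sym N≡) (ℕ.+-monoˡ-≤ 2 (ℕ.+-mono-≤ (ℕ.m≤m+n 3 (j * 3)) (subst (3 ≤_) (sym b≡3+j′*3) (ℕ.m≤m+n 3 (j′ * 3)))))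

proposition4p23 : (d₁ d₂ : ℕ) → 1 ≤ d₁ → 1 ≤ d₂ → 3 ∣ (d₁ + d₂) →
    (((d₁ % 3 ≡ 1 × d₂ % 3 ≡ 2) ⊎ (d₁ % 3 ≡ 2 × d₂ % 3 ≡ 1)) →
      IsZ3Ramsey (S d₁ d₂) (d₁ + d₂ + 3))
    × ((d₁ % 3 ≡ 0 × d₂ % 3 ≡ 0) →
      IsZ3Ramsey (S d₁ d₂) (d₁ + d₂ + 2))
proposition4p23 d₁ d₂ 1≤d₁ 1≤d₂ _ = residues-1-2 , residues-0-0
  where
  nonzero : ∀ {d} {r : ℤ₃} → d % 3 ≡ toℕ r → r ≢ 0F → [ d ]₃ ≢ 0F
  nonzero {d} d%3≡r r≢0 = r≢0 ∘ trans (sym ([n]₃-from-% {d} d%3≡r))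
  residues-1-2 : ((d₁ % 3 ≡ 1 × d₂ % 3 ≡ 2) ⊎ (d₁ % 3 ≡ 2 × d₂ % 3 ≡ 1)) → IsZ3Ramsey (S d₁ d₂) (d₁ + d₂ + 3)
  residues-1-2 (inj₁ (r₁ , r₂)) =
    (λ χ χ-sym → zero-sum-copy χ (zero-sum-stars-1-2 χ χ-sym r₁ r₂ refl)) ,
    (λ M → lower-bound-1-2 (nonzero {d₁} {1F} r₁ λ ()) (nonzero {d₂} {2F} r₂ λ ()))
  residues-1-2 (inj₂ (r₁ , r₂)) =
    (λ χ χ-sym → zero-sum-copy χ (swap-stars χ (zero-sum-stars-1-2 χ χ-sym r₂ r₁ (cong (_+ 3) (ℕ.+-comm d₂ d₁))))) ,
    (λ M → lower-bound-1-2 (nonzero {d₁} {2F} r₁ λ ()) (nonzero {d₂} {1F} r₂ λ ()))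
  residues-0-0 : (d₁ % 3 ≡ 0 × d₂ % 3 ≡ 0) → IsZ3Ramsey (S d₁ d₂) (d₁ + d₂ + 2)
  residues-0-0 (r₁ , r₂) =
    (λ χ χ-sym → zero-sum-copy χ (zero-sum-stars-0-0 χ χ-sym 1≤d₁ 1≤d₂ r₁ r₂ refl)) ,
    (λ M → lower-bound)
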